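{- Let $(G,\sigma)$ be a bipartite graph with $\sigma$ the vertex 2-coloring given by its bipartition. Algorithm HEART-TREE applied to $G$ returns a tree $(T,\sigma,u)$ if and only if $G$ is a un2qBMG. Moreover, in that case the returned tree $(T,\sigma,u)$ explains $G$ and is least-resolved.
   Context: Trees are rooted (root $\rho$) and phylogenetic; $a\preceq b$ means $a$ is a descendant of or equal to $b$; $\mathrm{lca}$ is the last common ancestor. A heart-vertex of a vertex-colored bipartite graph is a vertex adjacent to all vertices of the opposite color. A un2qBMG is the underlying undirected graph of a 2-colored quasi-best match graph (2qBMG): for a tree $T$ with leaf-coloring $\sigma$ into two colors and truncation map $u$ assigning each leaf $x$ a vertex $u(x)$ on the root-to-$x$ path, the 2qBMG has arcs $x\to y$ iff $\sigma(x)\ne\sigma(y)$, $\mathrm{lca}(x,y)\preceq\mathrm{lca}(x,z)$ for all leaves $z$ of color $\sigma(y)$, and $\mathrm{lca}(x,y)\preceq u(x)$. A tree $(T,\sigma,u)$ with $u(x)\in\{x,\rho\}$ explains $(G,\sigma)$ if $V(G)=L(T)$ and $xy\in E(G)$ iff $\sigma(x)\ne\sigma(y)$ and either ($u(x)\neq x$ and $y\preceq\mathrm{lca}(x,z)$ for all leaves $z$ with $\sigma(z)=\sigma(y)$) or ($u(y)\ne y$ and $x\preceq\mathrm{lca}(y,z)$ for all leaves $z$ with $\sigma(z)=\sigma(x)$). It is least-resolved if no tree $(T',\sigma,u')$ explaining $G$ has $T'$ obtained from $T$ by a nonempty sequence of contractions of internal arcs. Algorithm HEART-TREE (input: bipartite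 graph $G$ with coloring $\sigma$ from the bipartition): Start with $T$ consisting of a single vertex $\rho$ and set $F(\rho):=V(G)$. If $|V(G)|=1$, with $V(G)=\{x\}$, identify $\rho$ with $x$ and set $u(x):=x$. Otherwise, while $T$ has a leaf $v$ that is not a vertex of $G$: let $G_v:=G[F(v)]$ and $H_v$ the set of heart-vertices of $G_v$; if $H_v=\emptyset$ and $G_v$ is connected, return false; otherwise, add each $x\in H_v$ as a child of $v$ with $u(x):=\rho$; let $G_v^-:=G_v[F(v)\setminus H_v]$; for each connected component $C$ of $G_v^-$, if $|V(C)|=1$ add its unique vertex $x$ as a child of $v$ with $u(x):=x$, else add a new child $w$ of $v$ with $F(w):=V(C)$. When the loop ends, return $(T,\sigma,u)$. -}

module Defs where

open import Data.Nat using (ℕ; zero; suc; _≤_; _≟_)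
open import Data.Fin using (Fin)
open import Data.Bool using (Bool; true; false)
open import Data.List using (List; []; _∷_; _++_; map; length)
open import Data.List.Membership.Propositional using (_∈_)
open import Data.List.Relation.Unary.All using (All)
open import Data.List.Relation.Unary.Unique.Propositional using (Unique)
open import Data.List.Relation.Binary.Pointwise using (Pointwise)
open import Data.Product using (Σ; _×_; _,_; ∃)
open import Data.Sum using (_⊎_)
open import Data.Unit using (⊤)
open import Relation.Nullary using (¬_; yes; no)
open import Relation.Binary.PropositionalEquality using (_≡_; _≢_)
open import Relation.Binary.Construct.Closure.ReflexiveTransitive using (Star)
open import Function using (_⇔_)
open import Level using (Level)

record BipGraph (n : ℕ) : Set where
  field
    adj    : Fin n → Fin n → Bool
    sym    : ∀ x y → adj x y ≡ adj y x
    irrefl : ∀ x → adj x x ≡ false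
    σ      : Fin n → Bool
    proper : ∀ x y → adj x y ≡ true → σ x ≢ σ y

  Edge : Fin n → Fin n → Set
  Edge x y = adj x y ≡ true

-- Rooted trees with leaves labelled by Fin n (children are ordered
-- lists; the order is irrelevant for everything below).

data Tree (n : ℕ) : Set where
  leaf : Fin n → Tree n
  node : List (Tree n) → Tree n

data _[_]≔_ {a} {A : Set a} : List A → ℕ → A → Set a where
  here  : ∀ {x xs} → (x ∷ xs) [ zero ]≔ x
  there : ∀ {x xs i y} → xs [ i ]≔ y → (x ∷ xs) [ suc i ]≔ y

-- Vertices of a tree are addressed by paths from the root (lists of
-- child indices); the root is [].  LeafAt t p x : leaf x sits at p.
data LeafAt {n : ℕ} : Tree n → List ℕ → Fin n → Set where
  here  : ∀ {x} → LeafAt (leaf x) [] x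
  child : ∀ {ts i t p x} → ts [ i ]≔ t → LeafAt t p x → LeafAt (node ts) (i ∷ p) x

data Phylo {n : ℕ} : Tree n → Set where
  leafP : ∀ {x} → Phylo (leaf x)
  nodeP : ∀ {ts} → 2 ≤ length ts → All Phylo ts → Phylo (node ts)

record PhyloTree (n : ℕ) : Set where
  field
    tree        : Tree n
    phylo       : Phylo tree
    addr        : Fin n → List ℕ
    addr-ok     : ∀ x → LeafAt tree (addr x) x
    addr-unique : ∀ x p → LeafAt tree p x → p ≡ addr x

-- a ⪯ b : vertex a is a descendant of (or equal to) vertex b,
-- i.e. the address b is a prefix of the address a.
_⪯_ : List ℕ → List ℕ → Set
a ⪯ b = Σ (List ℕ) λ r → b ++ r ≡ a

-- lca of two vertices = longest common prefix of their addresses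
lcp : List ℕ → List ℕ → List ℕ
lcp (a ∷ as) (b ∷ bs) with a ≟ b
... | yes _ = a ∷ lcp as bs
... | no _  = []
lcp _ _ = []

lca : ∀ {n} → PhyloTree n → Fin n → Fin n → List ℕ
lca T x y = lcp (PhyloTree.addr T x) (PhyloTree.addr T y)

module _ {n : ℕ} (G : BipGraph n) where
  open BipGraph G

  -- arc x → y of the 2qBMG of (T, σ, u); u x is a vertex on the
  -- root-to-x path (an ancestor of x, possibly x itself)
  QArc : (T : PhyloTree n) → (Fin n → List ℕ) → Fin n → Fin n → Set
  QArc T u x y =
    σ x ≢ σ y
    × (∀ z → σ z ≡ σ y → lca T x y ⪯ lca T x z)
    × lca T x y ⪯ u x

  Un2qBMG : Set
  Un2qBMG =
    Σ (PhyloTree n) λ T →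
    Σ (Fin n → List ℕ) λ u →
      (∀ x → PhyloTree.addr T x ⪯ u x)
      × (∀ x y → Edge x y ⇔ (QArc T u x y ⊎ QArc T u y x))

-- Truncation maps with u(x) ∈ {x, ρ}

data Trunc : Set where
  atLeaf atRoot : Trunc

truncV : Trunc → List ℕ → List ℕ
truncV atLeaf p = p
truncV atRoot p = []

module _ {n : ℕ} (G : BipGraph n) where
  open BipGraph G

  Explains : PhyloTree n → (Fin n → Trunc) → Set
  Explains T u = ∀ x y → Edge x y ⇔
    (σ x ≢ σ y ×
      ((truncV (u x) (addr x) ≢ addr x × (∀ z → σ z ≡ σ y → addr y ⪯ lca T x z))
       ⊎ (truncV (u y) (addr y) ≢ addr y × (∀ z → σ z ≡ σ x → addr x ⪯ lca T y z))))
    where open PhyloTree T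

data Contract1 {n : ℕ} : Tree n → Tree n → Set where
  here   : ∀ {as ss bs} → Contract1 (node (as ++ node ss ∷ bs)) (node (as ++ ss ++ bs))
  deeper : ∀ {as bs t t'} → Contract1 t t' → Contract1 (node (as ++ t ∷ bs)) (node (as ++ t' ∷ bs))

data Contract⁺ {n : ℕ} : Tree n → Tree n → Set where
  one  : ∀ {t t'} → Contract1 t t' → Contract⁺ t t'
  more : ∀ {t t' t''} → Contract1 t t' → Contract⁺ t' t'' → Contract⁺ t t''

module _ {n : ℕ} (G : BipGraph n) where

  LeastResolved : PhyloTree n → (Fin n → Trunc) → Set
  LeastResolved T u =
    ¬ (Σ (PhyloTree n) λ T' → Contract⁺ (PhyloTree.tree T) (PhyloTree.tree T')
         × Σ (Fin n → Trunc) λ u' → Explains G T' u')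

-- Algorithm HEART-TREE, as a relation describing its (successful) runs.
-- Vertex subsets are predicates on Fin n.

module _ {n : ℕ} (G : BipGraph n) where
  open BipGraph G

  Heart : (Fin n → Set) → Fin n → Set
  Heart S x = S x × (∀ y → S y → σ y ≢ σ x → Edge x y)

  Reach : (Fin n → Set) → Fin n → Fin n → Set
  Reach S = Star (λ a b → S a × S b × Edge a b)

  Connected : (Fin n → Set) → Set
  Connected S = ∀ x y → S x → S y → Reach S x y

  IsComponent : (Fin n → Set) → (Fin n → Set) → Set
  IsComponent S C =
    (∃ λ x → C x)
    × (∀ x → C x → S x)
    × Connected C
    × (∀ x y → C x → S y → Edge x y → C y)

  Components : (Fin n → Set) → List (Fin n → Set) → Set₁
  Components S Cs =
    All (IsComponent S) Cs
    × (∀ x → S x → Σ ℕ λ i → Σ (Fin n → Set) λ C →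
         Cs [ i ]≔ C × C x × (∀ j D → Cs [ j ]≔ D → D x → j ≡ i))

  HeartList : (Fin n → Set) → List (Fin n) → Set
  HeartList S hs = Unique hs × (∀ x → (x ∈ hs ⇔ Heart S x))

  mutual
    -- Build u S t : processing a vertex v with F(v) = S (|S| ≥ 2) does
    -- not fail and produces the subtree t rooted at v, with the values
    -- of u as assigned by the algorithm for the leaves below v.
    data Build (u : Fin n → Trunc) (S : Fin n → Set) : Tree n → Set₁ where
      step : (hs : List (Fin n)) (Cs : List (Fin n → Set)) (ts : List (Tree n))
           → HeartList S hs
           → ¬ (hs ≡ [] × Connected S)
           → All (λ x → u x ≡ atRoot) hs
           → Components (λ x → S x × ¬ Heart S x) Cs
           → Pointwise (Child u) Cs ts
           → Build u S (node (map leaf hs ++ ts))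

    data Child (u : Fin n → Trunc) (C : Fin n → Set) : Tree n → Set₁ where
      single : ∀ x → C x → (∀ y → C y → y ≡ x) → u x ≡ atLeaf → Child u C (leaf x)
      multi  : ∀ {t} x y → C x → C y → x ≢ y → Build u C t → Child u C t

  -- HeartTree u t : algorithm HEART-TREE applied to (G, σ) returns (T, σ, u)
  -- with underlying tree t.
  data HeartTree (u : Fin n → Trunc) : Tree n → Set₁ where
    single : ∀ x → (∀ y → y ≡ x) → u x ≡ atLeaf → HeartTree u (leaf x)
    multi  : ∀ {t} (x y : Fin n) → x ≢ y → Build u (λ _ → ⊤) t → HeartTree u t

-- Below a vertex v, HEART-TREE hangs one leaf for each heart-vertex of G_v, truncated at the root,
-- and one subtree for each connected component of G_v^-.  By induction on the run this tree
-- explains G: a heart explains its edges through the root; no edge joins two components, and a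
-- truncated vertex x of a component with two vertices has a vertex z of the other colour in its own
-- subtree, so lca(x, z) is not the root and x can explain only vertices of that subtree.
--
-- In a un2qBMG, every connected vertex set S with two vertices contains an arc a → b whose lca lies
-- above all of S: otherwise a path in S leaves the cluster of lca(a, b) along an edge, whose arc has
-- a strictly higher lca.  The tail a of such an arc is a heart-vertex of G[S], so HEART-TREE never
-- fails on a un2qBMG; it terminates because every component of G_v^- is a proper subset of F(v).
--
-- Contracting arcs of the returned tree removes the cluster of an inner vertex w, created for a
-- component F of G_v^-.  If the contracted tree explained G, the same argument would give an arc
-- a → b inside F whose lca covers F; its cluster is a cluster of the original tree, it cannot be
-- the cluster of w, so it contains F(v) and a would be a heart-vertex of G_v.

module Submission where

open import Defs
open import Data.Nat using (ℕ; zero; suc; _≤_; _<_; _+_; _≟_; z≤n; s≤s)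
open import Data.Nat.Properties
  using (≤-refl; ≤-trans; <-≤-trans; ≤-pred; <-irrefl; n≮n; +-suc; +-identityʳ; +-monoˡ-≤; +-cancelˡ-≡;
         m≤n+m; m≢1+m+n; suc-injective)
open import Data.Fin using (Fin; zero; suc)
open import Data.Fin.Properties using (any?; all?) renaming (_≟_ to _≟ᶠ_)
open import Data.Fin.Subset as Subset using (Subset; _⊂_; _∪_; ⁅_⁆; ∣_∣) renaming (_∈_ to _∈ₛ_)
open import Data.Fin.Subset.Properties
  using (∣p∣≤n; p⊂q⇒∣p∣<∣q∣; p⊆p∪q; q⊆p∪q; x∈p∪q⁻; x∈⁅x⁆; x∈⁅y⁆⇒x≡y; ⊥⊆; ∉⊥; ∣⊥∣≡0; ∈⊤)
  renaming (_∈?_ to _∈ₛ?_)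
open import Data.Bool using (true; if_then_else_)
open import Data.Bool.Properties using (¬-not; not-injective) renaming (_≟_ to _≟ᵇ_)
open import Data.List using (List; []; _∷_; _++_; length; map; filter; allFin)
open import Data.List.Properties using (++-identityʳ; ++-assoc; ++-cancelˡ; ∷-injective)
open import Data.List.Membership.Propositional using (_∈_)
import Data.List.Membership.DecPropositional as DecMembership
open import Data.List.Membership.Propositional.Properties using (∈-filter⁺; ∈-filter⁻; ∈-allFin)
open import Data.List.Relation.Unary.Any as Any using (Any; here; there)
open import Data.List.Relation.Unary.All as All using (All; []; _∷_)
import Data.List.Relation.Unary.All.Properties as Allₚ
open import Data.List.Relation.Unary.AllPairs using (_∷_)
open import Data.List.Relation.Unary.Unique.Propositional using (Unique)
open import Data.List.Relation.Unary.Unique.Propositional.Properties using (filter⁺; allFin⁺)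
open import Data.List.Relation.Binary.Pointwise as Pointwise using (Pointwise; []; _∷_; Pointwise-≡⇒≡)
open import Data.List.Relation.Binary.Prefix.Heterogeneous as Prefix using (Prefix; []; _∷_; _++ᵖ_)
import Data.List.Relation.Binary.Prefix.Heterogeneous.Properties as Prefixₚ
open import Data.Product using (Σ; _×_; _,_; proj₁; proj₂; map₂)
open import Data.Sum as Sum using (_⊎_; inj₁; inj₂)
open import Data.Unit using (⊤; tt)
open import Data.Empty using (⊥; ⊥-elim)
open import Level using (Level; 0ℓ; _⊔_) renaming (suc to lsuc)
open import Relation.Nullary using (¬_; Dec; yes; no; does; ¬?)
open import Relation.Nullary.Decidable using (_×-dec_; _→-dec_)
open import Relation.Unary using (Decidable)
open import Relation.Binary.PropositionalEquality using (_≡_; _≢_; refl; sym; trans; cong; subst)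
open import Relation.Binary.Construct.Closure.ReflexiveTransitive using (ε; _◅_; _◅◅_; gmap; reverse)
open import Function using (_⇔_; mk⇔; Equivalence)
import Function.Properties.Equivalence as ⇔

-- Addresses and the prefix order

-- p ⊑ q : the vertex at address p is an ancestor of (or equal to) the vertex at q, i.e. q ⪯ p.
infix 4 _⊑_
_⊑_ : List ℕ → List ℕ → Set
_⊑_ = Prefix _≡_

⊑-refl : ∀ {p} → p ⊑ p
⊑-refl = Prefixₚ.fromPointwise (Pointwise.refl refl)

⊑-trans : ∀ {p q r} → p ⊑ q → q ⊑ r → p ⊑ r
⊑-trans = Prefixₚ.trans trans

⊑-antisym : ∀ {p q} → p ⊑ q → q ⊑ p → p ≡ q
⊑-antisym p⊑q q⊑p = Pointwise-≡⇒≡ (Prefixₚ.antisym (λ e _ → e) p⊑q q⊑p)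

_⊑?_ : ∀ p q → Dec (p ⊑ q)
_⊑?_ = Prefixₚ.prefix? _≟_

⊑-++ : ∀ p r → p ⊑ p ++ r
⊑-++ p r = ⊑-refl ++ᵖ r

⊑⇒++ : ∀ {p a} → p ⊑ a → Σ (List ℕ) λ r → a ≡ p ++ r
⊑⇒++ {a = a} [] = a , refl
⊑⇒++ (refl ∷ p⊑a) with ⊑⇒++ p⊑a
... | r , refl = r , refl

⪯⇒⊑ : ∀ {a b} → a ⪯ b → b ⊑ a
⪯⇒⊑ {b = b} (r , refl) = ⊑-++ b r

⊑⇒⪯ : ∀ {a b} → b ⊑ a → a ⪯ b
⊑⇒⪯ b⊑a with ⊑⇒++ b⊑a
... | r , refl = r , refl

⊑-connex : ∀ {p q a} → p ⊑ a → q ⊑ a → p ⊑ q ⊎ q ⊑ p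
⊑-connex [] _ = inj₁ []
⊑-connex (_ ∷ _) [] = inj₂ []
⊑-connex (refl ∷ p⊑a) (refl ∷ q⊑a) with ⊑-connex p⊑a q⊑a
... | inj₁ p⊑q = inj₁ (refl ∷ p⊑q)
... | inj₂ q⊑p = inj₂ (refl ∷ q⊑p)

⊏⇒length< : ∀ {p q} → p ⊑ q → ¬ q ⊑ p → length p < length q
⊏⇒length< {q = []} [] q⋢p = ⊥-elim (q⋢p [])
⊏⇒length< {q = _ ∷ _} [] _ = s≤s z≤n
⊏⇒length< (refl ∷ p⊑q) q⋢p = s≤s (⊏⇒length< p⊑q λ q⊑p → q⋢p (refl ∷ q⊑p))

⊑-∷ʳ⁻ : ∀ {q} p i → q ⊑ p ++ i ∷ [] → ¬ p ++ i ∷ [] ⊑ q → q ⊑ p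
⊑-∷ʳ⁻ [] i [] _ = []
⊑-∷ʳ⁻ (_ ∷ _) i [] _ = []
⊑-∷ʳ⁻ [] i (refl ∷ []) q⋢ = ⊥-elim (q⋢ (refl ∷ []))
⊑-∷ʳ⁻ (j ∷ p) i (refl ∷ q⊑) q⋢ = refl ∷ ⊑-∷ʳ⁻ p i q⊑ λ r → q⋢ (refl ∷ r)

⊑-parent : ∀ {q a} p i → q ⊑ a → p ++ i ∷ [] ⊑ a → ¬ p ++ i ∷ [] ⊑ q → q ⊑ p
⊑-parent p i q⊑a w⊑a w⋢q with ⊑-connex q⊑a w⊑a
... | inj₁ q⊑w = ⊑-∷ʳ⁻ p i q⊑w w⋢q
... | inj₂ w⊑q = ⊥-elim (w⋢q w⊑q)

lcp-⊑ˡ : ∀ a b → lcp a b ⊑ a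
lcp-⊑ˡ [] b = []
lcp-⊑ˡ (i ∷ a) [] = []
lcp-⊑ˡ (i ∷ a) (j ∷ b) with i ≟ j
... | yes _ = refl ∷ lcp-⊑ˡ a b
... | no _ = []

lcp-⊑ʳ : ∀ a b → lcp a b ⊑ b
lcp-⊑ʳ [] b = []
lcp-⊑ʳ (i ∷ a) [] = []
lcp-⊑ʳ (i ∷ a) (j ∷ b) with i ≟ j
... | yes refl = refl ∷ lcp-⊑ʳ a b
... | no _ = []

lcp-greatest : ∀ {c} a b → c ⊑ a → c ⊑ b → c ⊑ lcp a b
lcp-greatest a b [] _ = []
lcp-greatest (i ∷ a) (.i ∷ b) (refl ∷ c⊑a) (refl ∷ c⊑b) with i ≟ i
... | yes refl = refl ∷ lcp-greatest a b c⊑a c⊑b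
... | no i≢i = ⊥-elim (i≢i refl)

lcp-comm : ∀ a b → lcp a b ≡ lcp b a
lcp-comm a b = ⊑-antisym (lcp-greatest b a (lcp-⊑ʳ a b) (lcp-⊑ˡ a b))
                         (lcp-greatest a b (lcp-⊑ʳ b a) (lcp-⊑ˡ b a))

lcp-∷ : ∀ i a b → lcp (i ∷ a) (i ∷ b) ≡ i ∷ lcp a b
lcp-∷ i a b with i ≟ i
... | yes _ = refl
... | no i≢i = ⊥-elim (i≢i refl)

lcp-∷-≢ : ∀ {i j} a b → i ≢ j → lcp (i ∷ a) (j ∷ b) ≡ []
lcp-∷-≢ {i} {j} a b i≢j with i ≟ j
... | yes i≡j = ⊥-elim (i≢j i≡j)
... | no _ = refl

lcp-[_] : ∀ k a → lcp (k ∷ []) a ≡ [] ⊎ k ∷ [] ⊑ a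
lcp-[ k ] [] = inj₁ refl
lcp-[ k ] (j ∷ a) with k ≟ j
... | yes refl = inj₂ (refl ∷ [])
... | no _ = inj₁ refl

lcp-length< : ∀ {w} a b → w ⊑ a → ¬ w ⊑ b → length (lcp a b) < length w
lcp-length< a b w⊑a w⋢b with ⊑-connex w⊑a (lcp-⊑ˡ a b)
... | inj₁ w⊑l = ⊥-elim (w⋢b (⊑-trans w⊑l (lcp-⊑ʳ a b)))
... | inj₂ l⊑w = ⊏⇒length< l⊑w λ w⊑l → w⋢b (⊑-trans w⊑l (lcp-⊑ʳ a b))

module _ {a} {A : Set a} where

  ≔-functional : ∀ {xs : List A} {i y z} → xs [ i ]≔ y → xs [ i ]≔ z → y ≡ z
  ≔-functional here here = refl
  ≔-functional (there p) (there q) = ≔-functional p q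

  ∈⇒≔ : ∀ {x : A} {xs} → x ∈ xs → Σ ℕ λ i → xs [ i ]≔ x
  ∈⇒≔ (here refl) = zero , here
  ∈⇒≔ (there x∈xs) with ∈⇒≔ x∈xs
  ... | i , xs[i] = suc i , there xs[i]

  ≔⇒∈ : ∀ {x : A} {xs i} → xs [ i ]≔ x → x ∈ xs
  ≔⇒∈ here = here refl
  ≔⇒∈ (there xs[i]) = there (≔⇒∈ xs[i])

  Any-≔ : ∀ {p} {P : A → Set p} {xs} → Any P xs → Σ ℕ λ i → Σ A λ x → xs [ i ]≔ x × P x
  Any-≔ (here px) = zero , _ , here , px
  Any-≔ (there pxs) with Any-≔ pxs
  ... | i , x , xs[i] , px = suc i , x , there xs[i] , px

  ≔-Any : ∀ {p} {P : A → Set p} {xs i x} → xs [ i ]≔ x → P x → Any P xs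
  ≔-Any here px = here px
  ≔-Any (there xs[i]) px = there (≔-Any xs[i] px)

  ≔-injective : ∀ {x : A} {xs i j} → Unique xs → xs [ i ]≔ x → xs [ j ]≔ x → i ≡ j
  ≔-injective _ here here = refl
  ≔-injective (x∉ ∷ _) here (there q) = ⊥-elim (All.lookup x∉ (≔⇒∈ q) refl)
  ≔-injective (x∉ ∷ _) (there p) here = ⊥-elim (All.lookup x∉ (≔⇒∈ p) refl)
  ≔-injective (_ ∷ u) (there p) (there q) = cong suc (≔-injective u p q)

  ≔-length : ∀ {xs : List A} {i y} → xs [ i ]≔ y → i < length xs
  ≔-length here = s≤s z≤n
  ≔-length (there p) = s≤s (≔-length p)

  ≔-++ˡ : ∀ {xs ys : List A} {i y} → xs [ i ]≔ y → (xs ++ ys) [ i ]≔ y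
  ≔-++ˡ here = here
  ≔-++ˡ (there p) = there (≔-++ˡ p)

  ≔-++ʳ : ∀ (xs : List A) {ys j y} → ys [ j ]≔ y → (xs ++ ys) [ length xs + j ]≔ y
  ≔-++ʳ [] p = p
  ≔-++ʳ (_ ∷ xs) p = there (≔-++ʳ xs p)

  ≔-++⁻ : ∀ (xs : List A) {ys i y} → (xs ++ ys) [ i ]≔ y →
          xs [ i ]≔ y ⊎ Σ ℕ λ j → i ≡ length xs + j × ys [ j ]≔ y
  ≔-++⁻ [] p = inj₂ (_ , refl , p)
  ≔-++⁻ (_ ∷ xs) here = inj₁ here
  ≔-++⁻ (_ ∷ xs) (there p) with ≔-++⁻ xs p
  ... | inj₁ q = inj₁ (there q)
  ... | inj₂ (j , refl , q) = inj₂ (j , refl , q)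

  ≔-middle : ∀ (xs : List A) {y ys} → (xs ++ y ∷ ys) [ length xs ]≔ y
  ≔-middle [] = here
  ≔-middle (_ ∷ xs) = there (≔-middle xs)

  ≔-replace : ∀ (xs : List A) {y y' ys i z} → (xs ++ y ∷ ys) [ i ]≔ z → i ≢ length xs →
              (xs ++ y' ∷ ys) [ i ]≔ z
  ≔-replace [] here i≢ = ⊥-elim (i≢ refl)
  ≔-replace [] (there p) _ = there p
  ≔-replace (_ ∷ xs) here _ = here
  ≔-replace (_ ∷ xs) (there p) i≢ = there (≔-replace xs p λ e → i≢ (cong suc e))

  ≔-All : ∀ {p} {P : A → Set p} {xs i y} → All P xs → xs [ i ]≔ y → P y
  ≔-All (py ∷ _) here = py
  ≔-All (_ ∷ ps) (there p) = ≔-All ps p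

  ≔-2≤length : ∀ {xs : List A} → 2 ≤ length xs → ∀ j → Σ ℕ λ i → Σ A λ y → i ≢ j × xs [ i ]≔ y
  ≔-2≤length {_ ∷ _ ∷ _} _ zero = 1 , _ , (λ ()) , there here
  ≔-2≤length {_ ∷ _ ∷ _} _ (suc j) = 0 , _ , (λ ()) , here
  ≔-2≤length {_ ∷ []} (s≤s ()) _

≔-map⁺ : ∀ {a b} {A : Set a} {B : Set b} (f : A → B) {xs i x} → xs [ i ]≔ x → map f xs [ i ]≔ f x
≔-map⁺ f here = here
≔-map⁺ f (there p) = there (≔-map⁺ f p)

≔-map⁻ : ∀ {a b} {A : Set a} {B : Set b} (f : A → B) {xs i y} → map f xs [ i ]≔ y →
         Σ A λ x → xs [ i ]≔ x × f x ≡ y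
≔-map⁻ f {_ ∷ _} here = _ , here , refl
≔-map⁻ f {_ ∷ _} (there p) with ≔-map⁻ f p
... | x , q , e = x , there q , e

module _ {a b r} {A : Set a} {B : Set b} {R : A → B → Set r} where

  Pointwise-≔ˡ : ∀ {xs ys i x} → Pointwise R xs ys → xs [ i ]≔ x → Σ B λ y → ys [ i ]≔ y × R x y
  Pointwise-≔ˡ (r ∷ _) here = _ , here , r
  Pointwise-≔ˡ (_ ∷ rs) (there p) with Pointwise-≔ˡ rs p
  ... | y , q , r = y , there q , r

  Pointwise-≔ʳ : ∀ {xs ys i y} → Pointwise R xs ys → ys [ i ]≔ y → Σ A λ x → xs [ i ]≔ x × R x y
  Pointwise-≔ʳ (r ∷ _) here = _ , here , r
  Pointwise-≔ʳ (_ ∷ rs) (there p) with Pointwise-≔ʳ rs p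
  ... | x , q , r = x , there q , r

-- Leaves and clusters

module _ {n : ℕ} where

  LeafAt-≔ : ∀ {ts : List (Tree n)} {i s s' a x} → ts [ i ]≔ s → ts [ i ]≔ s' → LeafAt s a x → LeafAt s' a x
  LeafAt-≔ p q = subst (λ s → LeafAt s _ _) (≔-functional p q)

  LeafAt-⊑ : ∀ {t : Tree n} {p q x y} → LeafAt t p x → LeafAt t q y → p ⊑ q → p ≡ q × x ≡ y
  LeafAt-⊑ here here [] = refl , refl
  LeafAt-⊑ (child ts[i] ℓ) (child ts[i]' ℓ') (refl ∷ p⊑q) with ≔-functional ts[i] ts[i]'
  ... | refl with LeafAt-⊑ ℓ ℓ' p⊑q
  ...   | refl , x≡y = refl , x≡y

  UniqueLeaves : Tree n → Set
  UniqueLeaves t = ∀ {p q x} → LeafAt t p x → LeafAt t q x → p ≡ q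

  data SubtreeAt : Tree n → List ℕ → Tree n → Set where
    here  : ∀ {t} → SubtreeAt t [] t
    child : ∀ {ts i t p s} → ts [ i ]≔ t → SubtreeAt t p s → SubtreeAt (node ts) (i ∷ p) s

  Cluster : Tree n → List ℕ → Fin n → Set
  Cluster t p x = Σ (List ℕ) λ r → LeafAt t (p ++ r) x

  SubtreeAt-LeafAt : ∀ {t p s r x} → SubtreeAt t p s → LeafAt s r x → LeafAt t (p ++ r) x
  SubtreeAt-LeafAt here ℓ = ℓ
  SubtreeAt-LeafAt (child ts[i] sub) ℓ = child ts[i] (SubtreeAt-LeafAt sub ℓ)

  SubtreeAt-parent : ∀ {t s} p {j r} → SubtreeAt t (p ++ j ∷ r) s →
                     Σ (List (Tree n)) λ ss → SubtreeAt t p (node ss) × Σ (Tree n) λ s' → ss [ j ]≔ s'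
  SubtreeAt-parent [] (child ts[j] _) = _ , here , _ , ts[j]
  SubtreeAt-parent (_ ∷ p) (child ts[i] sub) with SubtreeAt-parent p sub
  ... | ss , sub' , s' = ss , child ts[i] sub' , s'

  SubtreeAt-Phylo : ∀ {t p s} → Phylo t → SubtreeAt t p s → Phylo s
  SubtreeAt-Phylo φ here = φ
  SubtreeAt-Phylo (nodeP _ φs) (child ts[i] sub) = SubtreeAt-Phylo (≔-All φs ts[i]) sub

  Phylo-leaf : ∀ {s} → Phylo s → Σ (Fin n) λ x → Σ (List ℕ) λ r → LeafAt s r x
  Phylo-leaf (leafP {x}) = x , [] , here
  Phylo-leaf (nodeP {_ ∷ _} _ (φ ∷ _)) with Phylo-leaf φ
  ... | x , r , ℓ = x , 0 ∷ r , child here ℓ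

  Cluster-anti : ∀ {t p q x} → p ⊑ q → Cluster t q x → Cluster t p x
  Cluster-anti {t} {p} {x = x} p⊑q (r , ℓ) with ⊑⇒++ p⊑q
  ... | r₀ , refl = r₀ ++ r , subst (λ a → LeafAt t a x) (++-assoc p r₀ r) ℓ

  Cluster⇒⊑ : ∀ {t p q x} → UniqueLeaves t → LeafAt t q x → Cluster t p x → p ⊑ q
  Cluster⇒⊑ {p = p} uniq ℓ (r , ℓ') = subst (p ⊑_) (uniq ℓ' ℓ) (⊑-++ p r)

  Cluster-child : ∀ {ts i s} → ts [ i ]≔ s → ∀ p x → Cluster (node ts) (i ∷ p) x ⇔ Cluster s p x
  Cluster-child ts[i] p x =
    mk⇔ (λ { (r , child ts[i]' ℓ) → r , LeafAt-≔ ts[i]' ts[i] ℓ })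
        (λ { (r , ℓ) → r , child ts[i] ℓ })

  Cluster-sameChild : ∀ {ts ts' i} → (∀ {s} → ts [ i ]≔ s → ts' [ i ]≔ s) →
                      (∀ {s} → ts' [ i ]≔ s → ts [ i ]≔ s) →
                      ∀ p x → Cluster (node ts) (i ∷ p) x ⇔ Cluster (node ts') (i ∷ p) x
  Cluster-sameChild to from p x =
    mk⇔ (λ { (r , child ts[i] ℓ) → r , child (to ts[i]) ℓ })
        (λ { (r , child ts[i] ℓ) → r , child (from ts[i]) ℓ })

  module _ (T : PhyloTree n) where
    open PhyloTree T

    PhyloTree-UniqueLeaves : UniqueLeaves tree
    PhyloTree-UniqueLeaves ℓ ℓ' = trans (addr-unique _ _ ℓ) (sym (addr-unique _ _ ℓ'))

    ⊑⇒Cluster : ∀ {p z} → p ⊑ addr z → Cluster tree p z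
    ⊑⇒Cluster {p} {z} p⊑z with ⊑⇒++ p⊑z
    ... | r , e = r , subst (λ a → LeafAt tree a z) e (addr-ok z)

  module _ {t : Tree n} (φ : Phylo t) (uniq : UniqueLeaves t) where

    -- A leaf below a sibling of the child j lies outside the cluster of a ++ j ∷ s.
    Cluster-⊂-descendant : ∀ {a ss} → SubtreeAt t a (node ss) → ∀ j s →
                           Σ (Fin n) λ z → Cluster t a z × ¬ Cluster t (a ++ j ∷ s) z
    Cluster-⊂-descendant {a} sub j s with SubtreeAt-Phylo φ sub
    ... | nodeP 2≤ φs with ≔-2≤length 2≤ j
    ...   | j' , s' , j'≢j , ss[j'] with Phylo-leaf (≔-All φs ss[j'])
    ...     | z , r , ℓ = z , (j' ∷ r , ℓz) , λ (r' , ℓ') → j'≢j (proj₁ (∷-injective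
                (++-cancelˡ a (j' ∷ r) (j ∷ s ++ r') (trans (uniq ℓz ℓ') (++-assoc a (j ∷ s) r')))))
      where
      ℓz : LeafAt t (a ++ j' ∷ r) z
      ℓz = SubtreeAt-LeafAt sub (child ss[j'] ℓ)

    Cluster-injective : ∀ {w ss} → SubtreeAt t w (node ss) →
                        ∀ q → (∀ x → Cluster t q x ⇔ Cluster t w x) → q ≡ w
    Cluster-injective {w} sub q q≈w with Phylo-leaf (SubtreeAt-Phylo φ sub)
    ... | x , r , ℓ with SubtreeAt-LeafAt sub ℓ
    ... | ℓw with ⊑-connex (Cluster⇒⊑ uniq ℓw (Equivalence.from (q≈w x) (r , ℓw))) (⊑-++ w r)
    ... | inj₁ q⊑w with ⊑⇒++ q⊑w
    ...   | [] , w≡q = sym (trans w≡q (++-identityʳ q))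
    ...   | j ∷ s , refl with SubtreeAt-parent q sub
    ...     | _ , subq , _ with Cluster-⊂-descendant subq j s
    ...       | z , z∈q , z∉w = ⊥-elim (z∉w (Equivalence.to (q≈w z) z∈q))
    Cluster-injective {w} sub q q≈w | _ | _ | inj₂ w⊑q with ⊑⇒++ w⊑q
    ...   | [] , q≡w = trans q≡w (++-identityʳ w)
    ...   | j ∷ s , refl with Cluster-⊂-descendant sub j s
    ...     | z , z∈w , z∉q = ⊥-elim (z∉q (Equivalence.from (q≈w z) z∈w))

-- Contraction of inner arcs

module _ {n : ℕ} where

  contracted : {t t' : Tree n} → Contract1 t t' → List ℕ
  contracted (here {as}) = length as ∷ []
  contracted (deeper {as} c) = length as ∷ contracted c

  contracted-inner : {t t' : Tree n} (c : Contract1 t t') → Σ (List (Tree n)) λ ss → SubtreeAt t (contracted c) (node ss)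
  contracted-inner (here {as}) = _ , child (≔-middle as) here
  contracted-inner (deeper {as} c) with contracted-inner c
  ... | ss , sub = ss , child (≔-middle as) sub

  contracted-nonroot : {t t' : Tree n} (c : Contract1 t t') → contracted c ≢ []
  contracted-nonroot here ()
  contracted-nonroot (deeper c) ()

  module ContractAtRoot (as ss bs : List (Tree n)) where
    t t' : Tree n
    t  = node (as ++ node ss ∷ bs)
    t' = node (as ++ ss ++ bs)

    grandchildLeaf : ∀ {j a x s} → ss [ j ]≔ s → LeafAt t (length as ∷ j ∷ a) x → LeafAt s a x
    grandchildLeaf ss[j] (child p ℓ) with ≔-functional p (≔-middle as)
    ... | refl with ℓ
    ...   | child q ℓ' = LeafAt-≔ q ss[j] ℓ'

    -- The i-th child of t' is a vertex q of t that is neither the contracted vertex nor one of its ancestors.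
    childAddress : ∀ {i s} → (as ++ ss ++ bs) [ i ]≔ s → Σ (List ℕ) λ q → (∀ r → q ++ r ≢ length as ∷ [])
                   × (∀ a x → LeafAt t' (i ∷ a) x ⇔ LeafAt t (q ++ a) x)
    childAddress {i} ts'[i] with ≔-++⁻ as ts'[i]
    ... | inj₁ as[i] = i ∷ [] , (λ r e → <-irrefl (proj₁ (∷-injective e)) (≔-length as[i]))
                     , λ a x → mk⇔ (λ { (child p ℓ) → child (≔-++ˡ as[i]) (LeafAt-≔ p ts'[i] ℓ) })
                                   (λ { (child p ℓ) → child ts'[i] (LeafAt-≔ p (≔-++ˡ as[i]) ℓ) })
    ... | inj₂ (j , refl , ssbs[j]) with ≔-++⁻ ss ssbs[j]
    ...   | inj₁ ss[j] = length as ∷ j ∷ [] , (λ r ())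
                       , λ a x → mk⇔ (λ { (child p ℓ) → child (≔-middle as) (child ss[j] (LeafAt-≔ p ts'[i] ℓ)) })
                                     (λ ℓ → child ts'[i] (grandchildLeaf ss[j] ℓ))
    ...   | inj₂ (k , refl , bs[k]) = length as + suc k ∷ []
                       , (λ r e → m≢1+m+n (length as) (sym (trans (sym (+-suc (length as) k)) (proj₁ (∷-injective e)))))
                       , λ a x → mk⇔ (λ { (child p ℓ) → child (≔-++ʳ as (there bs[k])) (LeafAt-≔ p ts'[i] ℓ) })
                                     (λ { (child p ℓ) → child ts'[i] (LeafAt-≔ p (≔-++ʳ as (there bs[k])) ℓ) })

    leafIn-t : ∀ {j b x} → LeafAt t (j ∷ b) x → Σ (List ℕ) λ a → LeafAt t' a x
    leafIn-t {j} {b} (child p ℓ) with ≔-++⁻ as p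
    ... | inj₁ as[j] = j ∷ b , child (≔-++ˡ as[j]) ℓ
    ... | inj₂ (_ , refl , here) with ℓ
    ...   | child ss[k] ℓ' = _ , child (≔-++ʳ as (≔-++ˡ ss[k])) ℓ'
    leafIn-t (child p ℓ) | inj₂ (_ , refl , there bs[k]) = _ , child (≔-++ʳ as (≔-++ʳ ss bs[k])) ℓ

  Contract1-leaves : ∀ {t t' : Tree n} → Contract1 t t' → ∀ x → Cluster t' [] x ⇔ Cluster t [] x
  Contract1-leaves (here {as} {ss} {bs}) x = mk⇔ to (λ { (_ ∷ _ , ℓ) → ContractAtRoot.leafIn-t as ss bs ℓ })
    where
    to : Cluster _ [] x → Cluster _ [] x
    to (i ∷ a , child p ℓ) with ContractAtRoot.childAddress as ss bs p
    ... | q , _ , q≈i = q ++ a , Equivalence.to (q≈i a x) (child p ℓ)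
  Contract1-leaves (deeper {as} c) x = mk⇔ (move (Contract1-leaves c x)) (move (⇔.sym (Contract1-leaves c x)))
    where
    move : ∀ {s s' bs} → Cluster s [] x ⇔ Cluster s' [] x →
           Cluster (node (as ++ s ∷ bs)) [] x → Cluster (node (as ++ s' ∷ bs)) [] x
    move {s} s≈s' (i ∷ a , child p ℓ) with i ≟ length as
    ... | no i≢ = i ∷ a , child (≔-replace as p i≢) ℓ
    ... | yes refl with ≔-functional p (≔-middle as)
    ...   | refl with Equivalence.to s≈s' (a , ℓ)
    ...     | a' , ℓ' = length as ∷ a' , child (≔-middle as) ℓ'

  Contract1-Cluster : ∀ {t t' : Tree n} (c : Contract1 t t') → ∀ p → (Σ (Fin n) λ x → Cluster t' p x) →
                      Σ (List ℕ) λ q → (∀ x → Cluster t' p x ⇔ Cluster t q x) × q ≢ contracted c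
  Contract1-Cluster c@here [] _ = [] , Contract1-leaves c , λ ()
  Contract1-Cluster (here {as} {ss} {bs}) (i ∷ r) (_ , _ , child p _) with ContractAtRoot.childAddress as ss bs p
  ... | q , q≢ , q≈i = q ++ r , (λ x → mk⇔ (to x) (from x)) , q≢ r
    where
    to : ∀ x → Cluster _ (i ∷ r) x → Cluster _ (q ++ r) x
    to x (r' , ℓ) = r' , subst (λ a → LeafAt _ a x) (sym (++-assoc q r r')) (Equivalence.to (q≈i (r ++ r') x) ℓ)
    from : ∀ x → Cluster _ (q ++ r) x → Cluster _ (i ∷ r) x
    from x (r' , ℓ) = r' , Equivalence.from (q≈i (r ++ r') x) (subst (λ a → LeafAt _ a x) (++-assoc q r r') ℓ)
  Contract1-Cluster c@(deeper _) [] _ = [] , Contract1-leaves c , λ ()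
  Contract1-Cluster (deeper {as} c) (i ∷ r) (x₀ , x₀∈) with i ≟ length as
  ... | no i≢ = i ∷ r , Cluster-sameChild (λ p → ≔-replace as p i≢) (λ p → ≔-replace as p i≢) r
              , λ e → i≢ (proj₁ (∷-injective e))
  ... | yes refl with Contract1-Cluster c r (x₀ , Equivalence.to (Cluster-child (≔-middle as) r x₀) x₀∈)
  ...   | q , r≈q , q≢ = length as ∷ q
        , (λ x → ⇔.trans (Cluster-child (≔-middle as) r x)
                         (⇔.trans (r≈q x) (⇔.sym (Cluster-child (≔-middle as) q x))))
        , λ e → q≢ (proj₂ (∷-injective e))

  ClustersOf⊆ : Tree n → Tree n → Set
  ClustersOf⊆ t' t = ∀ p → (Σ (Fin n) λ x → Cluster t' p x) →
                     Σ (List ℕ) λ q → ∀ x → Cluster t' p x ⇔ Cluster t q x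

  Contract⁺-ClustersOf⊆ : ∀ {t t'} → Contract⁺ t t' → ClustersOf⊆ t' t
  Contract⁺-ClustersOf⊆ (one c) p x∈ with Contract1-Cluster c p x∈
  ... | q , p≈q , _ = q , p≈q
  Contract⁺-ClustersOf⊆ (more c c⁺) p (x , x∈p) with Contract⁺-ClustersOf⊆ c⁺ p (x , x∈p)
  ... | q₁ , p≈q₁ with Contract1-Cluster c q₁ (x , Equivalence.to (p≈q₁ x) x∈p)
  ...   | q , q₁≈q , _ = q , λ y → ⇔.trans (p≈q₁ y) (q₁≈q y)

  Contract⁺-firstStep : ∀ {t t'} → Contract⁺ t t' → Σ (Tree n) λ t₁ → Contract1 t t₁ × ClustersOf⊆ t' t₁
  Contract⁺-firstStep (one c) = _ , c , λ p _ → p , λ x → ⇔.refl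
  Contract⁺-firstStep (more c c⁺) = _ , c , Contract⁺-ClustersOf⊆ c⁺

  Contract⁺-lostCluster : ∀ {t t'} → Phylo t → UniqueLeaves t → Contract⁺ t t' →
                          Σ (List ℕ) λ w → Σ (List (Tree n)) λ ss → SubtreeAt t w (node ss) × w ≢ [] ×
                            (∀ p → ¬ (∀ x → Cluster t' p x ⇔ Cluster t w x))
  Contract⁺-lostCluster {t} φ uniq c⁺ with Contract⁺-firstStep c⁺
  ... | t₁ , c , t'⊆t₁ with contracted-inner c
  ...   | ss , sub = contracted c , ss , sub , contracted-nonroot c , lost
    where
    lost : ∀ p → ¬ (∀ x → Cluster _ p x ⇔ Cluster t (contracted c) x)
    lost p p≈w with Phylo-leaf (SubtreeAt-Phylo φ sub)
    ... | x , r , ℓ with Equivalence.from (p≈w x) (r , SubtreeAt-LeafAt sub ℓ)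
    ...   | x∈p with t'⊆t₁ p (x , x∈p)
    ...     | q₁ , p≈q₁ with Contract1-Cluster c q₁ (x , Equivalence.to (p≈q₁ x) x∈p)
    ...       | q , q₁≈q , q≢w = q≢w (Cluster-injective φ uniq sub q
                  λ y → ⇔.trans (⇔.sym (q₁≈q y)) (⇔.trans (⇔.sym (p≈q₁ y)) (p≈w y)))

-- Bipartite graphs and quasi-best match graphs

module _ {n : ℕ} (G : BipGraph n) where
  open BipGraph G renaming (sym to adj-sym)

  Edge-sym : ∀ {x y} → Edge x y → Edge y x
  Edge-sym {x} {y} e = trans (adj-sym y x) e

  third-colour : ∀ {x y z} → σ x ≢ σ y → σ x ≢ σ z → σ z ≡ σ y
  third-colour x≢y x≢z = not-injective (trans (sym (¬-not x≢z)) (¬-not x≢y))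

  Reach-mono : ∀ {C S : Fin n → Set} → (∀ x → C x → S x) → ∀ {a b} → Reach G C a b → Reach G S a b
  Reach-mono C⊆S = gmap (λ x → x) (λ (Ca , Cb , e) → C⊆S _ Ca , C⊆S _ Cb , e)

  module _ {S C : Fin n → Set} (isComp : IsComponent G S C) where

    IsComponent-⊆ : ∀ x → C x → S x
    IsComponent-⊆ = proj₁ (proj₂ isComp)

    IsComponent-connected : Connected G C
    IsComponent-connected = proj₁ (proj₂ (proj₂ isComp))

    IsComponent-closed : ∀ x y → C x → S y → Edge x y → C y
    IsComponent-closed = proj₂ (proj₂ (proj₂ isComp))

  private
    neighbourOnPath : ∀ {C : Fin n → Set} {x w} → Reach G C x w → x ≢ w → Σ (Fin n) λ z → C z × σ z ≢ σ x
    neighbourOnPath ε x≢x = ⊥-elim (x≢x refl)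
    neighbourOnPath ((_ , Cz , e) ◅ _) _ = _ , Cz , λ z~x → proper _ _ e (sym z~x)

  Connected-otherColour : ∀ {C : Fin n → Set} {x a b} → Connected G C → C x → C a → C b → a ≢ b →
                          Σ (Fin n) λ z → C z × σ z ≢ σ x
  Connected-otherColour {C} {x} {a} {b} connected Cx Ca Cb a≢b with x ≟ᶠ a
  ... | no x≢a = neighbourOnPath {C} (connected x a Cx Ca) x≢a
  ... | yes refl = neighbourOnPath {C} (connected x b Cx Cb) a≢b

  ExplainedBy : PhyloTree n → (Fin n → Trunc) → Fin n → Fin n → Set
  ExplainedBy T u x y = truncV (u x) (addr x) ≢ addr x × (∀ z → σ z ≡ σ y → addr y ⪯ lca T x z)
    where open PhyloTree T

  module _ (T : PhyloTree n) (u : Fin n → Trunc) (explains : Explains G T u) where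
    open PhyloTree T

    private
      truncAddr : Fin n → List ℕ
      truncAddr x = truncV (u x) (addr x)

      truncAddr-below : ∀ x → addr x ⪯ truncAddr x
      truncAddr-below x with u x
      ... | atLeaf = ⊑⇒⪯ ⊑-refl
      ... | atRoot = ⊑⇒⪯ []

      leaves-incomparable : ∀ {x y} → σ x ≢ σ y → ¬ addr x ⊑ addr y
      leaves-incomparable x≢y x⊑y = x≢y (cong σ (proj₂ (LeafAt-⊑ (addr-ok _) (addr-ok _) x⊑y)))

      Explained⇒QArc : ∀ {x y} → σ x ≢ σ y → ExplainedBy T u x y → QArc G T truncAddr x y
      Explained⇒QArc {x} {y} x≢y (truncated , below) =
        x≢y , (λ z z~y → ⊑⇒⪯ (lcp-greatest (addr x) (addr y) (lcp-⊑ˡ (addr x) (addr z)) (⪯⇒⊑ (below z z~y))))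
            , belowTrunc
        where
        belowTrunc : lca T x y ⪯ truncAddr x
        belowTrunc with u x
        ... | atLeaf = ⊥-elim (truncated refl)
        ... | atRoot = ⊑⇒⪯ []

      QArc⇒Explained : ∀ {x y} → QArc G T truncAddr x y → ExplainedBy T u x y
      QArc⇒Explained {x} {y} (x≢y , least , belowTrunc) =
        truncated , λ z z~y → ⊑⇒⪯ (⊑-trans (⪯⇒⊑ (least z z~y)) (lcp-⊑ʳ (addr x) (addr y)))
        where
        truncated : truncAddr x ≢ addr x
        truncated with u x
        ... | atLeaf = λ _ → leaves-incomparable x≢y (⊑-trans (⪯⇒⊑ belowTrunc) (lcp-⊑ʳ (addr x) (addr y)))
        ... | atRoot = λ e → leaves-incomparable x≢y (subst (_⊑ addr y) e [])

      Edge⇔QArc : ∀ x y → Edge x y ⇔ (QArc G T truncAddr x y ⊎ QArc G T truncAddr y x)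
      Edge⇔QArc x y = mk⇔ to from
        where
        to : Edge x y → QArc G T truncAddr x y ⊎ QArc G T truncAddr y x
        to e with Equivalence.to (explains x y) e
        ... | x≢y , inj₁ xy = inj₁ (Explained⇒QArc x≢y xy)
        ... | x≢y , inj₂ yx = inj₂ (Explained⇒QArc (λ e → x≢y (sym e)) yx)
        from : QArc G T truncAddr x y ⊎ QArc G T truncAddr y x → Edge x y
        from (inj₁ a) = Equivalence.from (explains x y) (proj₁ a , inj₁ (QArc⇒Explained a))
        from (inj₂ a) = Equivalence.from (explains x y) ((λ e → proj₁ a (sym e)) , inj₂ (QArc⇒Explained a))

    Explains⇒Un2qBMG : Un2qBMG G
    Explains⇒Un2qBMG = T , truncAddr , truncAddr-below , Edge⇔QArc

  module _ (T : PhyloTree n) (u : Fin n → List ℕ)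
           (Edge⇔QArc : ∀ x y → Edge x y ⇔ (QArc G T u x y ⊎ QArc G T u y x)) where
    open PhyloTree T

    Covers : (Fin n → Set) → Fin n → Fin n → Set
    Covers S a b = ∀ z → S z → lca T a b ⊑ addr z

    QArc-covered⇒Edge : ∀ {a b} → QArc G T u a b → ∀ z → lca T a b ⊑ addr z → σ z ≢ σ a → Edge a z
    QArc-covered⇒Edge {a} {b} (a≢b , least , belowU) z ab⊑z z≢a =
      Equivalence.from (Edge⇔QArc a z) (inj₁ (a≢z , least' , ⊑⇒⪯ (⊑-trans (⪯⇒⊑ belowU) ab⊑az)))
      where
      a≢z : σ a ≢ σ z
      a≢z e = z≢a (sym e)
      ab⊑az : lca T a b ⊑ lca T a z
      ab⊑az = lcp-greatest (addr a) (addr z) (lcp-⊑ˡ (addr a) (addr b)) ab⊑z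
      least' : ∀ z' → σ z' ≡ σ z → lca T a z ⪯ lca T a z'
      least' z' z'~z = ⊑⇒⪯ (⊑-trans (⪯⇒⊑ (least z' (trans z'~z (third-colour a≢b a≢z)))) ab⊑az)

    covering⇒Heart : ∀ {S a b} → S a → QArc G T u a b → Covers S a b → Heart G S a
    covering⇒Heart Sa arc covers = Sa , λ z Sz z≢a → QArc-covered⇒Edge arc z (covers z Sz) z≢a

    module _ {S : Fin n → Set} (connected : Connected G S)
             (uncovered : ∀ a b → S a → S b → QArc G T u a b → ¬ Covers S a b) where

      -- An edge of S leaving the cluster of lca(a, b) yields an arc whose lca is strictly higher.
      private
        noArc : ∀ k a b → S a → S b → QArc G T u a b → length (lca T a b) < k → ⊥
        noArc (suc k) a b Sa Sb arc (s≤s len≤k) = uncovered a b Sa Sb arc covers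
          where
          w : List ℕ
          w = lca T a b
          higher : ∀ {c d} → w ⊑ addr c → ¬ w ⊑ addr d → length (lca T c d) < k
          higher {c} {d} w⊑c w⋢d = <-≤-trans (lcp-length< (addr c) (addr d) w⊑c w⋢d) len≤k
          crossing : ∀ {c d} → S c → S d → Edge c d → w ⊑ addr c → ¬ w ⊑ addr d → ⊥
          crossing {c} {d} Sc Sd e w⊑c w⋢d with Equivalence.to (Edge⇔QArc c d) e
          ... | inj₁ arc' = noArc k c d Sc Sd arc' (higher w⊑c w⋢d)
          ... | inj₂ arc' = noArc k d c Sd Sc arc'
                              (subst (λ l → length l < k) (lcp-comm (addr c) (addr d)) (higher w⊑c w⋢d))
          walk : ∀ {c d} → Reach G S c d → w ⊑ addr c → w ⊑ addr d
          walk ε w⊑c = w⊑c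
          walk (_◅_ {j = d} (Sc , Sd , e) path) w⊑c with w ⊑? addr d
          ... | yes w⊑d = walk path w⊑d
          ... | no w⋢d = ⊥-elim (crossing Sc Sd e w⊑c w⋢d)
          covers : Covers S a b
          covers z Sz = walk (connected a z Sa Sz) (lcp-⊑ˡ (addr a) (addr b))

      uncovered⇒subsingleton : ∀ {x y} → S x → S y → x ≢ y → ⊥
      uncovered⇒subsingleton {x} {y} Sx Sy x≢y with connected x y Sx Sy
      ... | ε = x≢y refl
      ... | (Sa , Sb , e) ◅ _ with Equivalence.to (Edge⇔QArc _ _) e
      ...   | inj₁ arc = noArc _ _ _ Sa Sb arc (s≤s ≤-refl)
      ...   | inj₂ arc = noArc _ _ _ Sb Sa arc (s≤s ≤-refl)

-- Runs of HEART-TREE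

module _ {n : ℕ} where

  data ChildView (hs : List (Fin n)) (ts : List (Tree n)) : ℕ → Tree n → Set where
    heartChild : ∀ {k h} → hs [ k ]≔ h → ChildView hs ts k (leaf h)
    compChild  : ∀ {k t} → ts [ k ]≔ t → ChildView hs ts (length hs + k) t

  childView : ∀ hs ts {i t} → (map leaf hs ++ ts) [ i ]≔ t → ChildView hs ts i t
  childView [] ts ts[i] = compChild ts[i]
  childView (h ∷ hs) ts here = heartChild here
  childView (h ∷ hs) ts (there p) with childView hs ts p
  ... | heartChild hs[k] = heartChild (there hs[k])
  ... | compChild ts[k] = compChild ts[k]

  heartChild-≔ : ∀ {hs : List (Fin n)} {ts : List (Tree n)} {k h} → hs [ k ]≔ h → (map leaf hs ++ ts) [ k ]≔ leaf h
  heartChild-≔ here = here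
  heartChild-≔ (there p) = there (heartChild-≔ p)

  compChild-≔ : ∀ (hs : List (Fin n)) {ts : List (Tree n)} {k t} → ts [ k ]≔ t →
                (map leaf hs ++ ts) [ length hs + k ]≔ t
  compChild-≔ [] p = p
  compChild-≔ (h ∷ hs) p = there (compChild-≔ hs p)

module _ {n : ℕ} (G : BipGraph n) where
  open DecMembership (_≟ᶠ_ {n}) using (_∈?_)

  Rest : (Fin n → Set) → Fin n → Set
  Rest S x = S x × ¬ Heart G S x

  HeartList-Heart : ∀ {S hs x} → HeartList G S hs → x ∈ hs → Heart G S x
  HeartList-Heart {x = x} hearts x∈hs = Equivalence.to (proj₂ hearts x) x∈hs

  module _ {S hs Cs} (hearts : HeartList G S hs) (comps : Components G (Rest S) Cs) where

    component : ∀ {i C} → Cs [ i ]≔ C → IsComponent G (Rest S) C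
    component Cs[i] = All.lookup (proj₁ comps) (≔⇒∈ Cs[i])

    component-⊆ : ∀ {i C x} → Cs [ i ]≔ C → C x → Rest S x
    component-⊆ Cs[i] Cx = IsComponent-⊆ G (component Cs[i]) _ Cx

    component-unique : ∀ {i j C D x} → Cs [ i ]≔ C → C x → Cs [ j ]≔ D → D x → i ≡ j
    component-unique {x = x} Cs[i] Cx Cs[j] Dx with proj₂ comps x (component-⊆ Cs[i] Cx)
    ... | _ , _ , _ , _ , unique = trans (unique _ _ Cs[i] Cx) (sym (unique _ _ Cs[j] Dx))

    heartOrComponent : ∀ {x} → S x → x ∈ hs ⊎ Σ ℕ λ i → Σ (Fin n → Set) λ C → Cs [ i ]≔ C × C x
    heartOrComponent {x} Sx with x ∈? hs
    ... | yes x∈hs = inj₁ x∈hs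
    ... | no x∉hs with proj₂ comps x (Sx , λ h → x∉hs (Equivalence.from (proj₂ hearts x) h))
    ...   | i , C , Cs[i] , Cx , _ = inj₂ (i , C , Cs[i] , Cx)

module _ {n : ℕ} (G : BipGraph n) (u : Fin n → Trunc) where

  mutual
    Build-leaf∈ : ∀ {S t p x} → Build G u S t → LeafAt t p x → S x
    Build-leaf∈ (step hs Cs ts hearts _ _ comps children) (child p ℓ) with childView hs ts p | ℓ
    ... | heartChild hs[k] | here = proj₁ (HeartList-Heart G hearts (≔⇒∈ hs[k]))
    ... | compChild ts[k] | _ with Children-leaf∈ children ts[k] ℓ
    ...   | C , Cs[k] , Cx = proj₁ (component-⊆ G hearts comps Cs[k] Cx)

    Child-leaf∈ : ∀ {C t p x} → Child G u C t → LeafAt t p x → C x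
    Child-leaf∈ (single _ Cx _ _) here = Cx
    Child-leaf∈ (multi _ _ _ _ _ b) ℓ = Build-leaf∈ b ℓ

    Children-leaf∈ : ∀ {Cs ts k t p x} → Pointwise (Child G u) Cs ts → ts [ k ]≔ t → LeafAt t p x →
                     Σ (Fin n → Set) λ C → Cs [ k ]≔ C × C x
    Children-leaf∈ (c ∷ _) here ℓ = _ , here , Child-leaf∈ c ℓ
    Children-leaf∈ (_ ∷ cs) (there p) ℓ with Children-leaf∈ cs p ℓ
    ... | C , Cs[k] , Cx = C , there Cs[k] , Cx

  mutual
    Build-leafOf : ∀ {S t x} → Build G u S t → S x → Σ (List ℕ) λ p → LeafAt t p x
    Build-leafOf (step hs Cs ts hearts _ _ comps children) Sx with heartOrComponent G hearts comps Sx
    ... | inj₁ x∈hs with ∈⇒≔ x∈hs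
    ...   | k , hs[k] = k ∷ [] , child (heartChild-≔ hs[k]) here
    Build-leafOf (step hs Cs ts hearts _ _ comps children) Sx | inj₂ (i , C , Cs[i] , Cx)
      with Children-leafOf children Cs[i] Cx
    ...   | t , ts[i] , p , ℓ = length hs + i ∷ p , child (compChild-≔ hs ts[i]) ℓ

    Child-leafOf : ∀ {C t x} → Child G u C t → C x → Σ (List ℕ) λ p → LeafAt t p x
    Child-leafOf (single _ _ only _) Cx with only _ Cx
    ... | refl = [] , here
    Child-leafOf (multi _ _ _ _ _ b) Cx = Build-leafOf b Cx

    Children-leafOf : ∀ {Cs ts i C x} → Pointwise (Child G u) Cs ts → Cs [ i ]≔ C → C x →
                      Σ (Tree n) λ t → ts [ i ]≔ t × Σ (List ℕ) λ p → LeafAt t p x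
    Children-leafOf (c ∷ _) here Cx = _ , here , Child-leafOf c Cx
    Children-leafOf (_ ∷ cs) (there p) Cx with Children-leafOf cs p Cx
    ... | t , ts[i] , ℓ = t , there ts[i] , ℓ

  heart∉children : ∀ {S hs Cs ts} → HeartList G S hs → Components G (Rest G S) Cs → Pointwise (Child G u) Cs ts →
                   ∀ {k k' h t r} → hs [ k ]≔ h → ts [ k' ]≔ t → LeafAt t r h → ⊥
  heart∉children hearts comps children hs[k] ts[k'] ℓ with Children-leaf∈ children ts[k'] ℓ
  ... | C , Cs[k'] , Ch = proj₂ (component-⊆ G hearts comps Cs[k'] Ch) (HeartList-Heart G hearts (≔⇒∈ hs[k]))

  mutual
    Build-UniqueLeaves : ∀ {S t} → Build G u S t → UniqueLeaves t
    Build-UniqueLeaves (step hs Cs ts hearts _ _ comps children) (child p ℓ) (child q ℓ')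
      with childView hs ts p | childView hs ts q | ℓ | ℓ'
    ... | heartChild hs[k] | heartChild hs[k'] | here | here = cong (_∷ []) (≔-injective (proj₁ hearts) hs[k] hs[k'])
    ... | heartChild hs[k] | compChild ts[k'] | here | _ = ⊥-elim (heart∉children hearts comps children hs[k] ts[k'] ℓ')
    ... | compChild ts[k] | heartChild hs[k'] | _ | here = ⊥-elim (heart∉children hearts comps children hs[k'] ts[k] ℓ)
    ... | compChild ts[k] | compChild ts[k'] | _ | _
      with Children-leaf∈ children ts[k] ℓ | Children-leaf∈ children ts[k'] ℓ'
    ...   | C , Cs[k] , Cx | D , Cs[k'] , Dx with component-unique G hearts comps Cs[k] Cx Cs[k'] Dx
    ...     | refl with ≔-functional ts[k] ts[k']
    ...       | refl = cong (_ ∷_) (Children-UniqueLeaves children ts[k] ℓ ℓ')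

    Child-UniqueLeaves : ∀ {C t} → Child G u C t → UniqueLeaves t
    Child-UniqueLeaves (single _ _ _ _) here here = refl
    Child-UniqueLeaves (multi _ _ _ _ _ b) = Build-UniqueLeaves b

    Children-UniqueLeaves : ∀ {Cs ts k t} → Pointwise (Child G u) Cs ts → ts [ k ]≔ t → UniqueLeaves t
    Children-UniqueLeaves (c ∷ _) here = Child-UniqueLeaves c
    Children-UniqueLeaves (_ ∷ cs) (there p) = Children-UniqueLeaves cs p

  private
    Pointwise-[] : ∀ {Cs} → Pointwise (Child G u) Cs [] → Cs ≡ []
    Pointwise-[] [] = refl

    Pointwise-[-] : ∀ {Cs t} → Pointwise (Child G u) Cs (t ∷ []) → Σ (Fin n → Set) λ C → Cs ≡ C ∷ []
    Pointwise-[-] (_∷_ {x = C} _ []) = C , refl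

  -- A vertex with at least two leaves below it gets at least two children: a single component
  -- and no hearts would make G[S] connected, a single heart and no components would make |S| = 1.
  step-2≤children : ∀ {S} hs Cs ts → HeartList G S hs → ¬ (hs ≡ [] × Connected G S) →
                    Components G (Rest G S) Cs → Pointwise (Child G u) Cs ts →
                    ∀ {x y} → S x → S y → x ≢ y → 2 ≤ length (map leaf hs ++ ts)
  step-2≤children [] Cs [] hearts _ comps children Sx _ _ with Pointwise-[] children
  ... | refl with heartOrComponent G hearts comps Sx
  ...   | inj₁ ()
  ...   | inj₂ (_ , _ , () , _)
  step-2≤children {S} [] Cs (t ∷ []) hearts fails comps children _ _ _ with Pointwise-[-] children
  ... | C , refl = ⊥-elim (fails (refl , connected))
    where
    S⊆C : ∀ {a} → S a → C a
    S⊆C Sa with heartOrComponent G hearts comps Sa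
    ... | inj₁ ()
    ... | inj₂ (_ , _ , here , Ca) = Ca
    C⊆S : ∀ {a} → C a → S a
    C⊆S Ca = proj₁ (component-⊆ G hearts comps here Ca)
    connected : Connected G S
    connected a b Sa Sb = Reach-mono G (λ _ → C⊆S)
                            (IsComponent-connected G (component G hearts comps here) a b (S⊆C Sa) (S⊆C Sb))
  step-2≤children [] Cs (_ ∷ _ ∷ _) _ _ _ _ _ _ _ = s≤s (s≤s z≤n)
  step-2≤children (h ∷ []) Cs [] hearts _ comps children Sx Sy x≢y with Pointwise-[] children
  ... | refl = ⊥-elim (x≢y (trans (onlyHeart Sx) (sym (onlyHeart Sy))))
    where
    onlyHeart : ∀ {a} → _ → a ≡ h
    onlyHeart Sa with heartOrComponent G hearts comps Sa
    ... | inj₁ (here a≡h) = a≡h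
    ... | inj₂ (_ , _ , () , _)
  step-2≤children (h ∷ []) Cs (_ ∷ _) _ _ _ _ _ _ _ = s≤s (s≤s z≤n)
  step-2≤children (_ ∷ _ ∷ _) Cs ts _ _ _ _ _ _ _ = s≤s (s≤s z≤n)

  mutual
    Build-Phylo : ∀ {S t x y} → Build G u S t → S x → S y → x ≢ y → Phylo t
    Build-Phylo (step hs Cs ts hearts fails _ comps children) Sx Sy x≢y =
      nodeP (step-2≤children hs Cs ts hearts fails comps children Sx Sy x≢y) (leaves-Phylo hs (Children-Phylo children))

    leaves-Phylo : ∀ hs {ts} → All Phylo ts → All Phylo (map leaf hs ++ ts)
    leaves-Phylo [] φs = φs
    leaves-Phylo (h ∷ hs) φs = leafP ∷ leaves-Phylo hs φs

    Child-Phylo : ∀ {C t} → Child G u C t → Phylo t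
    Child-Phylo (single _ _ _ _) = leafP
    Child-Phylo (multi _ _ Cx Cy x≢y b) = Build-Phylo b Cx Cy x≢y

    Children-Phylo : ∀ {Cs ts} → Pointwise (Child G u) Cs ts → All Phylo ts
    Children-Phylo [] = []
    Children-Phylo (c ∷ cs) = Child-Phylo c ∷ Children-Phylo cs

  runTree : ∀ {t} → HeartTree G u t → PhyloTree n
  runTree {t} (single x all _) = record
    { tree = t ; phylo = leafP ; addr = λ _ → []
    ; addr-ok = λ y → subst (LeafAt (leaf x) []) (sym (all y)) here
    ; addr-unique = λ { y p here → refl } }
  runTree {t} (multi x y x≢y b) = record
    { tree = t ; phylo = Build-Phylo b tt tt x≢y
    ; addr = λ z → proj₁ (Build-leafOf {x = z} b tt)
    ; addr-ok = λ z → proj₂ (Build-leafOf {x = z} b tt)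
    ; addr-unique = λ z p ℓ → Build-UniqueLeaves b ℓ (proj₂ (Build-leafOf {x = z} b tt)) }

  runTree-tree : ∀ {t} (h : HeartTree G u t) → PhyloTree.tree (runTree h) ≡ t
  runTree-tree (single _ _ _) = refl
  runTree-tree (multi _ _ _ _) = refl

  -- The induction hypothesis is available for the children built from components with two vertices.
  InductiveStep : ∀ {ℓ} → ((Fin n → Set) → Tree n → Set ℓ) → Set (lsuc 0ℓ ⊔ ℓ)
  InductiveStep P = ∀ {S} hs Cs ts (hearts : HeartList G S hs) (fails : ¬ (hs ≡ [] × Connected G S))
                    (hs-atRoot : All (λ x → u x ≡ atRoot) hs) (comps : Components G (Rest G S) Cs)
                    (children : Pointwise (Child G u) Cs ts) →
                    (∀ {i C t a b} → Cs [ i ]≔ C → ts [ i ]≔ t → C a → C b → a ≢ b → P C t) →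
                    P S (node (map leaf hs ++ ts))

  module _ {ℓ : Level} (P : (Fin n → Set) → Tree n → Set ℓ) (step-P : InductiveStep P) where
    mutual
      Build-ind : ∀ {S t} → Build G u S t → P S t
      Build-ind (step hs Cs ts hearts fails hs-atRoot comps children) =
        step-P hs Cs ts hearts fails hs-atRoot comps children (Children-ind children)

      Children-ind : ∀ {Cs ts} → Pointwise (Child G u) Cs ts →
                     ∀ {i C t a b} → Cs [ i ]≔ C → ts [ i ]≔ t → C a → C b → a ≢ b → P C t
      Children-ind (single _ _ only _ ∷ _) here here Ca Cb a≢b = ⊥-elim (a≢b (trans (only _ Ca) (sym (only _ Cb))))
      Children-ind (multi _ _ _ _ _ b ∷ _) here here _ _ _ = Build-ind b
      Children-ind (_ ∷ cs) (there p) (there q) Ca Cb a≢b = Children-ind cs p q Ca Cb a≢b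

-- Runs explain G

module _ {n : ℕ} (G : BipGraph n) (u : Fin n → Trunc) where
  open BipGraph G hiding (sym)

  -- The second conjunct of ExplainedBy, for a tree that is not yet known to be a PhyloTree and
  -- relative to the leaves in S.
  BelowAll : Tree n → (Fin n → Set) → Fin n → Fin n → Set
  BelowAll t S x y = ∀ z {ax ay az} → LeafAt t ax x → LeafAt t ay y → LeafAt t az z → S z → σ z ≡ σ y →
                     lcp ax az ⊑ ay

  ExplainedIn : Tree n → (Fin n → Set) → Fin n → Fin n → Set
  ExplainedIn t S x y = u x ≡ atRoot × BelowAll t S x y

  ExplainsOn : (Fin n → Set) → Tree n → Set
  ExplainsOn S t = ∀ x y → S x → S y → σ x ≢ σ y → Edge x y ⇔ (ExplainedIn t S x y ⊎ ExplainedIn t S y x)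

  private
    ⇔-swap : ∀ {x y} {A B : Set} → Edge y x ⇔ (A ⊎ B) → Edge x y ⇔ (B ⊎ A)
    ⇔-swap e⇔ = mk⇔ (λ e → Sum.swap (Equivalence.to e⇔ (Edge-sym G e)))
                     (λ ab → Edge-sym G (Equivalence.from e⇔ (Sum.swap ab)))

  module Step {S} hs Cs ts (hearts : HeartList G S hs) (fails : ¬ (hs ≡ [] × Connected G S))
         (hs-atRoot : All (λ x → u x ≡ atRoot) hs) (comps : Components G (Rest G S) Cs)
         (children : Pointwise (Child G u) Cs ts)
         (IH : ∀ {i C t a b} → Cs [ i ]≔ C → ts [ i ]≔ t → C a → C b → a ≢ b → ExplainsOn C t) where
    N : Tree n
    N = node (map leaf hs ++ ts)

    uniq : UniqueLeaves N
    uniq = Build-UniqueLeaves G u (step hs Cs ts hearts fails hs-atRoot comps children)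

    -- A heart x sits directly below the root, so lca(x, z) is the root unless z = x.
    heartEdge : ∀ {x y} → x ∈ hs → S y → σ x ≢ σ y → Edge x y ⇔ (ExplainedIn N S x y ⊎ ExplainedIn N S y x)
    heartEdge {x} {y} x∈hs Sy x≢y = mk⇔ (λ _ → inj₁ (All.lookup hs-atRoot x∈hs , below))
                                        (λ _ → proj₂ (HeartList-Heart G hearts x∈hs) y Sy (λ e → x≢y (sym e)))
      where
      k : ℕ
      k = proj₁ (∈⇒≔ x∈hs)
      ℓx : LeafAt N (k ∷ []) x
      ℓx = child (heartChild-≔ (proj₂ (∈⇒≔ x∈hs))) here
      below : BelowAll N S x y
      below z {az = az} ℓx' _ ℓz _ z~y with uniq ℓx' ℓx
      ... | refl with lcp-[ k ] az
      ...   | inj₁ lcp≡[] = subst (_⊑ _) (sym lcp≡[]) []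
      ...   | inj₂ k⊑az = ⊥-elim (x≢y (trans (cong σ (proj₂ (LeafAt-⊑ ℓx ℓz k⊑az))) z~y))

    childOf : ∀ {i C x} → Cs [ i ]≔ C → C x → Σ (Tree n) λ t → ts [ i ]≔ t × Child G u C t
              × Σ (List ℕ) λ p → LeafAt t p x × LeafAt N (length hs + i ∷ p) x
    childOf Cs[i] Cx with Pointwise-≔ˡ children Cs[i]
    ... | t , ts[i] , c with Child-leafOf G u c Cx
    ...   | p , ℓ = t , ts[i] , c , p , ℓ , child (compChild-≔ hs ts[i]) ℓ

    -- A truncated x (u x = ρ) lies in a component with another vertex z of y's colour; z lies in
    -- the same subtree as x, so lca(x, z) is strictly below the root and y must lie in that subtree too.
    notExplainedAcross : ∀ {i j C D x y} → Cs [ i ]≔ C → C x → Cs [ j ]≔ D → D y → i ≢ j → σ x ≢ σ y →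
                         ¬ ExplainedIn N S x y
    notExplainedAcross Cs[i] Cx Cs[j] Dy i≢j x≢y (x-atRoot , below) with childOf Cs[i] Cx
    ... | _ , _ , single _ _ only x-atLeaf , _ with only _ Cx
    ...   | refl with trans (sym x-atRoot) x-atLeaf
    ...     | ()
    notExplainedAcross {i} {j} {C} {x = x} {y} Cs[i] Cx Cs[j] Dy i≢j x≢y (x-atRoot , below)
      | t , ts[i] , c@(multi a b Ca Cb a≢b _) , px , _ , ℓx
      with Connected-otherColour G (IsComponent-connected G (component G hearts comps Cs[i])) Cx Ca Cb a≢b
    ... | z , Cz , z≢x with Child-leafOf G u c Cz | childOf Cs[j] Dy
    ...   | pz , ℓz | _ , _ , _ , py , _ , ℓy = i≢j (+-cancelˡ-≡ (length hs) _ _ (Prefix.head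
            (subst (_⊑ _) (lcp-∷ _ px pz) (below z ℓx ℓy (child (compChild-≔ hs ts[i]) ℓz)
              (proj₁ (component-⊆ G hearts comps Cs[i] Cz)) (third-colour G x≢y (λ e → z≢x (sym e)))))))

    edgeAcross : ∀ {i j C D x y} → Cs [ i ]≔ C → C x → Cs [ j ]≔ D → D y → i ≢ j → σ x ≢ σ y →
                 Edge x y ⇔ (ExplainedIn N S x y ⊎ ExplainedIn N S y x)
    edgeAcross {x = x} {y} Cs[i] Cx Cs[j] Dy i≢j x≢y = mk⇔
      (λ e → ⊥-elim (i≢j (component-unique G hearts comps Cs[i]
                          (IsComponent-closed G (component G hearts comps Cs[i]) x y Cx
                                 (component-⊆ G hearts comps Cs[j] Dy) e) Cs[j] Dy)))
      λ { (inj₁ xy) → ⊥-elim (notExplainedAcross Cs[i] Cx Cs[j] Dy i≢j x≢y xy)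
        ; (inj₂ yx) → ⊥-elim (notExplainedAcross Cs[j] Dy Cs[i] Cx (λ e → i≢j (sym e)) (λ e → x≢y (sym e)) yx) }

    module _ {i C t} (Cs[i] : Cs [ i ]≔ C) (ts[i] : ts [ i ]≔ t) (leaves⊆C : ∀ {z r} → LeafAt t r z → C z) where
      k : ℕ
      k = length hs + i
      ℓ↑ : ∀ {r z} → LeafAt t r z → LeafAt N (k ∷ r) z
      ℓ↑ = child (compChild-≔ hs ts[i])

      BelowAll↑ : ∀ {v w pv pw} → LeafAt t pv v → LeafAt t pw w → BelowAll t C v w → BelowAll N S v w
      BelowAll↑ {pv = pv} ℓv ℓw below z {az = az} ℓv' ℓw' ℓz Sz z~w
        with uniq ℓv' (ℓ↑ ℓv) | uniq ℓw' (ℓ↑ ℓw) | ℓz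
      ... | refl | refl | child {i = j} {p = az'} p ℓz' with j ≟ k
      ...   | no j≢k = subst (_⊑ _) (sym (lcp-∷-≢ pv az' λ e → j≢k (sym e))) []
      ...   | yes refl with ≔-functional p (compChild-≔ hs ts[i])
      ...     | refl = subst (_⊑ _) (sym (lcp-∷ k pv az')) (refl ∷ below z ℓv ℓw ℓz' (leaves⊆C ℓz') z~w)

      BelowAll↓ : ∀ {v w} → BelowAll N S v w → BelowAll t C v w
      BelowAll↓ below z {av} {az = az} ℓv ℓw ℓz Cz z~w = Prefix.tail (subst (_⊑ _) (lcp-∷ k av az)
        (below z (ℓ↑ ℓv) (ℓ↑ ℓw) (ℓ↑ ℓz) (proj₁ (component-⊆ G hearts comps Cs[i] Cz)) z~w))

    edgeWithin : ∀ {i C x y} → Cs [ i ]≔ C → C x → C y → σ x ≢ σ y →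
                 Edge x y ⇔ (ExplainedIn N S x y ⊎ ExplainedIn N S y x)
    edgeWithin {C = C} {x} {y} Cs[i] Cx Cy x≢y with childOf Cs[i] Cx | childOf Cs[i] Cy
    ... | _ , _ , single _ _ only _ , _ | _ = ⊥-elim (x≢y (cong σ (trans (only _ Cx) (sym (only _ Cy)))))
    ... | t , ts[i] , multi a b Ca Cb a≢b run , _ , ℓx , _ | _ , ts[i]' , _ , _ , ℓy , _ with ≔-functional ts[i] ts[i]'
    ...   | refl = mk⇔
      (λ e → Sum.map (map₂ (BelowAll↑ Cs[i] ts[i] (Build-leaf∈ G u run) ℓx ℓy))
                     (map₂ (BelowAll↑ Cs[i] ts[i] (Build-leaf∈ G u run) ℓy ℓx))
                     (Equivalence.to IH-edge e))
      (λ e → Equivalence.from IH-edge (Sum.map (map₂ (BelowAll↓ Cs[i] ts[i] (Build-leaf∈ G u run)))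
                                               (map₂ (BelowAll↓ Cs[i] ts[i] (Build-leaf∈ G u run))) e))
      where
      IH-edge : Edge x y ⇔ (ExplainedIn t C x y ⊎ ExplainedIn t C y x)
      IH-edge = IH Cs[i] ts[i] Ca Cb a≢b _ _ Cx Cy x≢y

    step-ExplainsOn : ExplainsOn S N
    step-ExplainsOn x y Sx Sy x≢y with heartOrComponent G hearts comps Sx | heartOrComponent G hearts comps Sy
    ... | inj₁ x∈hs | _ = heartEdge x∈hs Sy x≢y
    ... | inj₂ _ | inj₁ y∈hs = ⇔-swap (heartEdge y∈hs Sx λ e → x≢y (sym e))
    ... | inj₂ (i , C , Cs[i] , Cx) | inj₂ (j , D , Cs[j] , Dy) with i ≟ j
    ...   | no i≢j = edgeAcross Cs[i] Cx Cs[j] Dy i≢j x≢y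
    ...   | yes refl with ≔-functional Cs[i] Cs[j]
    ...     | refl = edgeWithin Cs[i] Cx Dy x≢y

  Build-ExplainsOn : ∀ {S t} → Build G u S t → ExplainsOn S t
  Build-ExplainsOn = Build-ind G u ExplainsOn Step.step-ExplainsOn

  runTree-Explains : ∀ {t} (h : HeartTree G u t) → Explains G (runTree G u h) u
  runTree-Explains (single x all _) y z =
    mk⇔ noEdge (λ (y≢z , _) → ⊥-elim (y≢z (cong σ (trans (all y) (sym (all z))))))
    where
    noEdge : Edge y z → _
    noEdge e with trans (all y) (sym (all z))
    ... | refl with trans (sym e) (irrefl y)
    ...   | ()
  runTree-Explains h@(multi _ _ _ b@(step _ _ _ _ _ _ _ _)) x y with σ x ≟ᵇ σ y
  ... | yes x~y = mk⇔ (λ e → ⊥-elim (proper x y e x~y)) (λ (x≢y , _) → ⊥-elim (x≢y x~y))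
  ... | no x≢y = mk⇔ (λ e → x≢y , Sum.map (fromRun x y) (fromRun y x) (Equivalence.to explainsOn e))
                     (λ (_ , e) → Equivalence.from explainsOn (Sum.map (toRun x y) (toRun y x) e))
    where
    open PhyloTree (runTree G u h)
    explainsOn : Edge x y ⇔ (ExplainedIn tree (λ _ → ⊤) x y ⊎ ExplainedIn tree (λ _ → ⊤) y x)
    explainsOn = Build-ExplainsOn b x y tt tt x≢y

    addr-nonroot : ∀ v → addr v ≢ []
    addr-nonroot v e with subst (λ p → LeafAt tree p v) e (addr-ok v)
    ... | ()

    fromRun : ∀ v w → ExplainedIn tree (λ _ → ⊤) v w → ExplainedBy G (runTree G u h) u v w
    fromRun v w (v-atRoot , below) =
      subst (λ τ → truncV τ (addr v) ≢ addr v) (sym v-atRoot) (λ e → addr-nonroot v (sym e))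
                                   , λ z z~w → ⊑⇒⪯ (below z (addr-ok v) (addr-ok w) (addr-ok z) tt z~w)

    toRun : ∀ v w → ExplainedBy G (runTree G u h) u v w → ExplainedIn tree (λ _ → ⊤) v w
    toRun v w (truncated , below) = v-atRoot , below'
      where
      v-atRoot : u v ≡ atRoot
      v-atRoot with u v
      ... | atLeaf = ⊥-elim (truncated refl)
      ... | atRoot = refl
      below' : BelowAll tree (λ _ → ⊤) v w
      below' z ℓv ℓw ℓz _ z~w rewrite addr-unique v _ ℓv | addr-unique w _ ℓw | addr-unique z _ ℓz =
        ⪯⇒⊑ (below z z~w)

-- Runs are least resolved

module _ {n : ℕ} (G : BipGraph n) (u : Fin n → Trunc) where

  -- An inner vertex w = parent ++ [index] of a run tree was created for a connected component F
  -- (with at least two vertices) of G_v^-, where v = parent has F(v) = F-parent.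
  record ComponentVertex (t : Tree n) (w : List ℕ) : Set₁ where
    field
      parent         : List ℕ
      index          : ℕ
      w≡             : w ≡ parent ++ index ∷ []
      F-parent F     : Fin n → Set
      F≈cluster      : ∀ x → F x ⇔ Cluster t w x
      F-parent⊆      : ∀ x → F-parent x → Cluster t parent x
      F⊆Rest         : ∀ x → F x → Rest G F-parent x
      F-connected    : Connected G F
      a b            : Fin n
      Fa             : F a
      Fb             : F b
      a≢b            : a ≢ b

  InnerVerticesFromComponents : (Fin n → Set) → Tree n → Set₁
  InnerVerticesFromComponents S t = ∀ w ss → SubtreeAt t w (node ss) → w ≢ [] → ComponentVertex t w

  step-InnerVerticesFromComponents : InductiveStep G u InnerVerticesFromComponents
  step-InnerVerticesFromComponents hs Cs ts hearts fails hs-atRoot comps children IH [] _ _ []≢[] = ⊥-elim ([]≢[] refl)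
  step-InnerVerticesFromComponents hs Cs ts hearts fails hs-atRoot comps children IH (j ∷ w) ss (child p sub) _
    with childView hs ts p
  ... | heartChild _ with sub
  ...   | ()
  step-InnerVerticesFromComponents {S} hs Cs ts hearts fails hs-atRoot comps children IH (j ∷ w) ss (child p sub) _
    | compChild ts[i] with Pointwise-≔ʳ children ts[i]
  ... | C , Cs[i] , c with w | sub | c
  ...   | [] | here | multi a b Ca Cb a≢b _ = record
          { parent = [] ; index = j ; w≡ = refl ; F-parent = S ; F = C
          ; F≈cluster = λ x → mk⇔ (λ Cx → let (r , ℓ) = Child-leafOf G u c Cx in r , child p ℓ)
                                  (λ { (r , child p' ℓ) → Child-leaf∈ G u c (LeafAt-≔ p' p ℓ) })
          ; F-parent⊆ = λ x Sx → Build-leafOf G u (step hs Cs ts hearts fails hs-atRoot comps children) Sx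
          ; F⊆Rest = λ x Cx → component-⊆ G hearts comps Cs[i] Cx
          ; F-connected = IsComponent-connected G (component G hearts comps Cs[i])
          ; a = a ; b = b ; Fa = Ca ; Fb = Cb ; a≢b = a≢b }
  ...   | _ ∷ _ | sub | multi a b Ca Cb a≢b _ = record
          { parent = j ∷ parent ; index = index ; w≡ = cong (j ∷_) w≡ ; F-parent = F-parent ; F = F
          ; F≈cluster = λ x → ⇔.trans (F≈cluster x) (⇔.sym (Cluster-child p _ x))
          ; F-parent⊆ = λ x Sx → Equivalence.from (Cluster-child p parent x) (F-parent⊆ x Sx)
          ; F⊆Rest = F⊆Rest ; F-connected = F-connected
          ; a = a' ; b = b' ; Fa = Fa ; Fb = Fb ; a≢b = a'≢b' }
    where
    open ComponentVertex (IH Cs[i] ts[i] Ca Cb a≢b _ ss sub (λ ()))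
      renaming (a to a'; b to b'; a≢b to a'≢b')

  Build-InnerVerticesFromComponents : ∀ {S t} → Build G u S t → InnerVerticesFromComponents S t
  Build-InnerVerticesFromComponents = Build-ind G u InnerVerticesFromComponents step-InnerVerticesFromComponents

  Build-notContractible : ∀ {t} → Build G u (λ _ → ⊤) t → ∀ {x y} → x ≢ y →
                          (T' : PhyloTree n) (uq : Fin n → List ℕ) →
                          Contract⁺ t (PhyloTree.tree T') →
                          (∀ x y → BipGraph.Edge G x y ⇔ (QArc G T' uq x y ⊎ QArc G T' uq y x)) → ⊥
  Build-notContractible {t} run x≢y T' uq c⁺ Edge⇔QArc
    with Contract⁺-lostCluster (Build-Phylo G u run tt tt x≢y) (Build-UniqueLeaves G u run) c⁺
  ... | w , ss , sub , w≢[] , lost = uncovered⇒subsingleton G T' uq Edge⇔QArc F-connected noCoveringArc Fa Fb a≢b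
    where
    open ComponentVertex (Build-InnerVerticesFromComponents run w ss sub w≢[])
    open PhyloTree T' using (addr-ok)

    uniq : UniqueLeaves t
    uniq = Build-UniqueLeaves G u run

    leafOf : ∀ z → Σ (List ℕ) λ p → LeafAt t p z
    leafOf z = Build-leafOf G u run tt

    noCoveringArc : ∀ a b → F a → F b → QArc G T' uq a b → ¬ Covers G T' uq Edge⇔QArc F a b
    noCoveringArc a b Fa Fb arc covers with Contract⁺-ClustersOf⊆ c⁺ (lca T' a b) (a , ⊑⇒Cluster T' (covers a Fa))
    ... | q , lca≈q with w ⊑? q
    ...   | yes w⊑q = lost (lca T' a b) λ z → mk⇔
              (λ z∈lca → Cluster-anti w⊑q (Equivalence.to (lca≈q z) z∈lca))
              (λ z∈w → ⊑⇒Cluster T' (covers z (Equivalence.from (F≈cluster z) z∈w)))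
    ...   | no w⋢q = proj₂ (F⊆Rest a Fa) (covering⇒Heart G T' uq Edge⇔QArc (proj₁ (F⊆Rest a Fa)) arc coversParent)
      where
      ℓa : LeafAt t (proj₁ (leafOf a)) a
      ℓa = proj₂ (leafOf a)
      q⊑parent : q ⊑ parent
      q⊑parent = ⊑-parent parent index
        (Cluster⇒⊑ uniq ℓa (Equivalence.to (lca≈q a) (⊑⇒Cluster T' (covers a Fa))))
        (subst (_⊑ _) w≡ (Cluster⇒⊑ uniq ℓa (Equivalence.to (F≈cluster a) Fa)))
        (λ r → w⋢q (subst (_⊑ q) (sym w≡) r))
      coversParent : Covers G T' uq Edge⇔QArc F-parent a b
      coversParent z Fz = Cluster⇒⊑ (PhyloTree-UniqueLeaves T') (addr-ok z)
        (Equivalence.from (lca≈q z) (Cluster-anti q⊑parent (F-parent⊆ z Fz)))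

  runTree-LeastResolved : ∀ {t} (h : HeartTree G u t) → LeastResolved G (runTree G u h) u
  runTree-LeastResolved (single _ _ _) (_ , one () , _)
  runTree-LeastResolved (single _ _ _) (_ , more () _ , _)
  runTree-LeastResolved (multi _ _ x≢y run) (T' , c⁺ , u' , explains') =
    Build-notContractible run x≢y T' (proj₁ (proj₂ un2q)) c⁺ (proj₂ (proj₂ (proj₂ un2q)))
    where
    un2q : Un2qBMG G
    un2q = Explains⇒Un2qBMG G T' u' explains'

-- Connected components

⟦_⟧ : ∀ {n} → Subset n → Fin n → Set
⟦ c ⟧ x = x ∈ₛ c

∈ₛ⇒0<∣∣ : ∀ {n x} {s : Subset n} → x ∈ₛ s → 0 < ∣ s ∣
∈ₛ⇒0<∣∣ {n} {s = s} x∈s = subst (_< ∣ s ∣) (∣⊥∣≡0 n) (p⊂q⇒∣p∣<∣q∣ (⊥⊆ , _ , x∈s , ∉⊥))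

DisjointList : ∀ {n} → List (Subset n) → Set
DisjointList cs = ∀ {i j c d y} → cs [ i ]≔ c → cs [ j ]≔ d → y ∈ₛ c → y ∈ₛ d → i ≡ j

module _ {n : ℕ} (G : BipGraph n) where
  open BipGraph G hiding (sym)

  Edge? : ∀ x y → Dec (Edge x y)
  Edge? x y = adj x y ≟ᵇ true

  module ComponentsOf (P : Fin n → Set) (P? : Decidable P) where

    ClosedIn : (Fin n → Set) → Set
    ClosedIn C = ∀ {a b} → C a → P b → Edge a b → C b

    Reach-closed : ∀ {C} → ClosedIn C → ∀ {a b} → C a → Reach G P a b → C b
    Reach-closed closed Ca ε = Ca
    Reach-closed closed Ca ((_ , Pb , e) ◅ path) = Reach-closed closed (closed Ca Pb e) path

    Reach-within : ∀ {C} → ClosedIn C → ∀ {a b} → C a → Reach G P a b → Reach G C a b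
    Reach-within closed Ca ε = ε
    Reach-within closed Ca ((_ , Pb , e) ◅ path) = (Ca , closed Ca Pb e , e) ◅ Reach-within closed (closed Ca Pb e) path

    private
      Reachable : Fin n → Subset n → Set
      Reachable x c = ∀ {y} → y ∈ₛ c → P y × Reach G P x y

      fuel-step : ∀ {a b k} → n < a + suc k → a < b → n < b + k
      fuel-step {a} {b} {k} fuel a<b = <-≤-trans (subst (n <_) (+-suc a k) fuel) (+-monoˡ-≤ k a<b)

      -- Every step adds a vertex to c, so n < ∣ c ∣ + k is enough fuel.
      grow : ∀ k {x} c → x ∈ₛ c → Reachable x c → n < ∣ c ∣ + k →
             Σ (Subset n) λ c' → x ∈ₛ c' × Reachable x c' × ClosedIn ⟦ c' ⟧
      grow zero c _ _ fuel = ⊥-elim (n≮n n (≤-trans (subst (n <_) (+-identityʳ ∣ c ∣) fuel) (∣p∣≤n c)))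
      grow (suc k) c x∈c reach fuel
        with any? (λ y → ¬? (y ∈ₛ? c) ×-dec P? y ×-dec any? (λ z → z ∈ₛ? c ×-dec Edge? z y))
      ... | no noExit = c , x∈c , reach , closed
        where
        closed : ClosedIn ⟦ c ⟧
        closed {a} {b} a∈c Pb e with b ∈ₛ? c
        ... | yes b∈c = b∈c
        ... | no b∉c = ⊥-elim (noExit (b , b∉c , Pb , a , a∈c , e))
      ... | yes (y , y∉c , Py , z , z∈c , e) =
        grow k (c ∪ ⁅ y ⁆) (p⊆p∪q ⁅ y ⁆ x∈c) reach' (fuel-step fuel (p⊂q⇒∣p∣<∣q∣ c⊂c∪y))
        where
        c⊂c∪y : c ⊂ c ∪ ⁅ y ⁆
        c⊂c∪y = p⊆p∪q ⁅ y ⁆ , y , q⊆p∪q c ⁅ y ⁆ (x∈⁅x⁆ y) , y∉c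
        reach' : Reachable _ (c ∪ ⁅ y ⁆)
        reach' v∈ with x∈p∪q⁻ c ⁅ y ⁆ v∈
        ... | inj₁ v∈c = reach v∈c
        ... | inj₂ v∈y with x∈⁅y⁆⇒x≡y y v∈y
        ...   | refl = Py , (proj₂ (reach z∈c) ◅◅ ((proj₁ (reach z∈c) , Py , e) ◅ ε))

    componentOf : ∀ {x} → P x → Σ (Subset n) λ c → IsComponent G P ⟦ c ⟧ × x ∈ₛ c
    componentOf {x} Px with grow (suc n) ⁅ x ⁆ (x∈⁅x⁆ x) start (m≤n+m (suc n) ∣ ⁅ x ⁆ ∣)
      where
      start : Reachable x ⁅ x ⁆
      start y∈ with x∈⁅y⁆⇒x≡y x y∈
      ... | refl = Px , ε
    ... | c , x∈c , reach , closed =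
      c , ((x , x∈c) , (λ y y∈c → proj₁ (reach y∈c)) , connected , λ a b → closed) , x∈c
      where
      connected : Connected G ⟦ c ⟧
      connected a b a∈c b∈c =
        reverse (λ (p , q , e) → q , p , Edge-sym G e) (Reach-within closed x∈c (proj₂ (reach a∈c)))
        ◅◅ Reach-within closed x∈c (proj₂ (reach b∈c))

    record Collected (xs : List (Fin n)) (cs : List (Subset n)) : Set where
      field
        areComponents : All (λ c → IsComponent G P ⟦ c ⟧) cs
        covers        : ∀ {x} → x ∈ xs → P x → Σ ℕ λ i → Σ (Subset n) λ c → cs [ i ]≔ c × x ∈ₛ c
        disjoint      : DisjointList cs

    collect : ∀ xs → Σ (List (Subset n)) (Collected xs)
    collect [] = [] , record { areComponents = [] ; covers = λ () ; disjoint = λ () }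
    collect (x ∷ xs) with collect xs
    ... | cs , col with P? x | Any.any? (x ∈ₛ?_) cs
    ...   | no ¬Px | _ = cs , record { areComponents = areComponents ; disjoint = disjoint
                                  ; covers = λ { (here refl) Px → ⊥-elim (¬Px Px) ; (there y∈xs) → covers y∈xs } }
      where open Collected col
    ...   | yes _ | yes covered = cs , record { areComponents = areComponents ; disjoint = disjoint
                                      ; covers = λ { (here refl) _ → Any-≔ covered ; (there y∈xs) → covers y∈xs } }
      where open Collected col
    ...   | yes Px | no uncovered with componentOf Px
    ...     | c , isComp , x∈c = c ∷ cs , record
      { areComponents = isComp ∷ areComponents
      ; covers = λ { (here refl) _ → 0 , c , here , x∈c
                   ; (there y∈xs) Py → let (i , d , cs[i] , y∈d) = covers y∈xs Py in suc i , d , there cs[i] , y∈d }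
      ; disjoint = disjoint' }
      where
      open Collected col
      -- A component meeting c contains x, which is uncovered.
      meets⇒covered : ∀ {i d y} → cs [ i ]≔ d → y ∈ₛ d → y ∈ₛ c → Any (x ∈ₛ_) cs
      meets⇒covered cs[i] y∈d y∈c =
        ≔-Any cs[i] (Reach-closed (IsComponent-closed G (≔-All areComponents cs[i]) _ _) y∈d
          (Reach-mono G (IsComponent-⊆ G isComp) (IsComponent-connected G isComp _ x y∈c x∈c)))
      disjoint' : DisjointList (c ∷ cs)
      disjoint' here here _ _ = refl
      disjoint' here (there cs[j]) y∈c y∈d = ⊥-elim (uncovered (meets⇒covered cs[j] y∈d y∈c))
      disjoint' (there cs[i]) here y∈d y∈c = ⊥-elim (uncovered (meets⇒covered cs[i] y∈d y∈c))
      disjoint' (there cs[i]) (there cs[j]) y∈c y∈d = cong suc (disjoint cs[i] cs[j] y∈c y∈d)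

    Collected⇒Components : ∀ {cs} → Collected (allFin n) cs → Components G P (map ⟦_⟧ cs)
    Collected⇒Components {cs} col = Allₚ.map⁺ areComponents , covers'
      where
      open Collected col
      covers' : ∀ x → P x → _
      covers' x Px with covers (∈-allFin x) Px
      ... | i , c , cs[i] , x∈c = i , ⟦ c ⟧ , ≔-map⁺ ⟦_⟧ cs[i] , x∈c , unique
        where
        unique : ∀ j D → map ⟦_⟧ cs [ j ]≔ D → D x → j ≡ i
        unique j D Cs[j] Dx with ≔-map⁻ ⟦_⟧ Cs[j]
        ... | d , cs[j] , refl = disjoint cs[j] cs[i] Dx x∈c

-- Running HEART-TREE on a un2qBMG

module _ {n : ℕ} (G : BipGraph n) where
  open BipGraph G hiding (sym)
  open DecMembership (_≟ᶠ_ {n}) using (_∈?_)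

  mutual
    Build-cong : ∀ {u u' S t} → (∀ y → S y → u y ≡ u' y) → Build G u S t → Build G u' S t
    Build-cong {u} u≗u' (step hs Cs ts hearts fails hs-atRoot comps children) =
      step hs Cs ts hearts fails
        (All.tabulate λ {x} x∈hs →
           trans (sym (u≗u' x (proj₁ (HeartList-Heart G hearts x∈hs)))) (All.lookup hs-atRoot x∈hs))
        comps (Children-cong (λ Cs[i] y Cy → u≗u' y (proj₁ (component-⊆ G hearts comps Cs[i] Cy))) children)

    Child-cong : ∀ {u u' C t} → (∀ y → C y → u y ≡ u' y) → Child G u C t → Child G u' C t
    Child-cong u≗u' (single x Cx only ux) = single x Cx only (trans (sym (u≗u' x Cx)) ux)
    Child-cong u≗u' (multi a b Ca Cb a≢b b') = multi a b Ca Cb a≢b (Build-cong u≗u' b')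

    Children-cong : ∀ {u u' Cs ts} → (∀ {i C} → Cs [ i ]≔ C → ∀ y → C y → u y ≡ u' y) →
                    Pointwise (Child G u) Cs ts → Pointwise (Child G u') Cs ts
    Children-cong u≗u' [] = []
    Children-cong u≗u' (c ∷ cs) = Child-cong (u≗u' here) c ∷ Children-cong (λ Cs[i] → u≗u' (there Cs[i])) cs

  SomeBuild SomeChild : (Fin n → Set) → Set₁
  SomeBuild S = Σ (Tree n) λ t → Σ (Fin n → Trunc) λ u → Build G u S t
  SomeChild C = Σ (Tree n) λ t → Σ (Fin n → Trunc) λ u → Child G u C t

  Heart? : ∀ {S} → Decidable S → Decidable (Heart G S)
  Heart? S? x = S? x ×-dec all? (λ y → S? y →-dec (¬? (σ y ≟ᵇ σ x) →-dec Edge? G x y))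

  Rest? : ∀ {S} → Decidable S → Decidable (Rest G S)
  Rest? S? v = S? v ×-dec ¬? (Heart? S? v)

  heartList : ∀ {S} → Decidable S → Σ (List (Fin n)) (HeartList G S)
  heartList S? = filter (Heart? S?) (allFin n)
               , filter⁺ (Heart? S?) (allFin⁺ n)
               , λ x → mk⇔ (λ x∈ → proj₂ (∈-filter⁻ (Heart? S?) {xs = allFin n} x∈))
                           (∈-filter⁺ (Heart? S?) (∈-allFin x))

  Rest-component-⊂ : ∀ {S} hs → HeartList G S hs → ¬ (hs ≡ [] × Connected G S) →
                     ∀ {C} → IsComponent G (Rest G S) C → ¬ (∀ v → S v → C v)
  Rest-component-⊂ [] _ fails (_ , C⊆Rest , connected , _) S⊆C = fails (refl , λ a b Sa Sb →
    Reach-mono G (λ v Cv → proj₁ (C⊆Rest v Cv)) (connected a b (S⊆C a Sa) (S⊆C b Sb)))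
  Rest-component-⊂ {S} (h ∷ _) hearts _ (_ , C⊆Rest , _) S⊆C = proj₂ (C⊆Rest h (S⊆C h (proj₁ heart))) heart
    where
    heart : Heart G S h
    heart = HeartList-Heart G hearts (here refl)

  Rest-component-smaller : ∀ {S} → Decidable S → ∀ {s} → (∀ {v} → S v → v ∈ₛ s) →
                           ∀ hs → HeartList G S hs → ¬ (hs ≡ [] × Connected G S) →
                           ∀ {c} → IsComponent G (Rest G S) ⟦ c ⟧ → ∣ c ∣ < ∣ s ∣
  Rest-component-smaller {S} S? S⊆s hs hearts fails {c} isComp with any? (λ v → S? v ×-dec ¬? (v ∈ₛ? c))
  ... | yes (v , Sv , v∉c) =
    p⊂q⇒∣p∣<∣q∣ ((λ w∈c → S⊆s (proj₁ (IsComponent-⊆ G isComp _ w∈c))) , v , S⊆s Sv , v∉c)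
  ... | no noneOutside = ⊥-elim (Rest-component-⊂ hs hearts fails isComp S⊆c)
    where
    S⊆c : ∀ v → S v → v ∈ₛ c
    S⊆c v Sv with v ∈ₛ? c
    ... | yes v∈c = v∈c
    ... | no v∉c = ⊥-elim (noneOutside (v , Sv , v∉c))

  childFor : ∀ {P} c → IsComponent G P ⟦ c ⟧ → (∀ {a b} → a ∈ₛ c → b ∈ₛ c → a ≢ b → SomeBuild ⟦ c ⟧) →
             SomeChild ⟦ c ⟧
  childFor c ((x , x∈c) , _) recurse with any? (λ a → any? (λ b → a ∈ₛ? c ×-dec b ∈ₛ? c ×-dec ¬? (a ≟ᶠ b)))
  ... | yes (a , b , a∈c , b∈c , a≢b) =
    let (t , u , build) = recurse a∈c b∈c a≢b in t , u , multi a b a∈c b∈c a≢b build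
  ... | no noPair = leaf x , (λ _ → atLeaf) , single x x∈c only refl
    where
    only : ∀ v → v ∈ₛ c → v ≡ x
    only v v∈c with v ≟ᶠ x
    ... | yes v≡x = v≡x
    ... | no v≢x = ⊥-elim (noPair (v , x , v∈c , x∈c , v≢x))

  -- The truncation maps of the children agree where they matter, because the components are disjoint.
  childrenFor : ∀ cs → DisjointList cs → (∀ {i c} → cs [ i ]≔ c → SomeChild ⟦ c ⟧) →
                Σ (List (Tree n)) λ ts → Σ (Fin n → Trunc) λ u → Pointwise (Child G u) (map ⟦_⟧ cs) ts
  childrenFor [] _ _ = [] , (λ _ → atLeaf) , []
  childrenFor (c ∷ cs) disjoint childOf
    with childOf here | childrenFor cs (λ p q y∈c y∈d → suc-injective (disjoint (there p) (there q) y∈c y∈d))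
                                       (λ p → childOf (there p))
  ... | t , uc , ch | ts , urest , chs = t ∷ ts , u , Child-cong agreeHere ch ∷ Children-cong agreeThere chs
    where
    u : Fin n → Trunc
    u v = if does (v ∈ₛ? c) then uc v else urest v
    agreeHere : ∀ v → v ∈ₛ c → uc v ≡ u v
    agreeHere v v∈c with v ∈ₛ? c
    ... | yes _ = refl
    ... | no v∉c = ⊥-elim (v∉c v∈c)
    agreeThere : ∀ {i D} → map ⟦_⟧ cs [ i ]≔ D → ∀ v → D v → urest v ≡ u v
    agreeThere Cs[i] v Dv with v ∈ₛ? c | ≔-map⁻ ⟦_⟧ Cs[i]
    ... | no _ | _ = refl
    ... | yes v∈c | d , cs[i] , refl with disjoint here (there cs[i]) v∈c Dv
    ...   | ()

  truncateHearts : ∀ {S hs Cs ts uK} → HeartList G S hs → Components G (Rest G S) Cs → Pointwise (Child G uK) Cs ts →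
                   Σ (Fin n → Trunc) λ u → All (λ v → u v ≡ atRoot) hs × Pointwise (Child G u) Cs ts
  truncateHearts {hs = hs} {uK = uK} hearts comps children = u , All.tabulate atRoot-if , Children-cong agree children
    where
    u : Fin n → Trunc
    u v = if does (v ∈? hs) then atRoot else uK v
    atRoot-if : ∀ {v} → v ∈ hs → u v ≡ atRoot
    atRoot-if {v} v∈hs with v ∈? hs
    ... | yes _ = refl
    ... | no v∉hs = ⊥-elim (v∉hs v∈hs)
    agree : ∀ {i C} → _ [ i ]≔ C → ∀ v → C v → uK v ≡ u v
    agree Cs[i] v Cv with v ∈? hs
    ... | no _ = refl
    ... | yes v∈hs = ⊥-elim (proj₂ (component-⊆ G hearts comps Cs[i] Cv) (HeartList-Heart G hearts v∈hs))

  module Construction (T : PhyloTree n) (uq : Fin n → List ℕ)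
                      (Edge⇔QArc : ∀ x y → Edge x y ⇔ (QArc G T uq x y ⊎ QArc G T uq y x)) where

    noFailure : ∀ {S hs x y} → HeartList G S hs → S x → S y → x ≢ y → ¬ (hs ≡ [] × Connected G S)
    noFailure {S} hearts Sx Sy x≢y (refl , connected) =
      uncovered⇒subsingleton G T uq Edge⇔QArc connected noHeart Sx Sy x≢y
      where
      noHeart : ∀ a b → S a → S b → QArc G T uq a b → ¬ Covers G T uq Edge⇔QArc S a b
      noHeart a b Sa _ arc covers with Equivalence.from (proj₂ hearts a) (covering⇒Heart G T uq Edge⇔QArc Sa arc covers)
      ... | ()

    -- The run is built by recursion on the size of a finite set s ⊇ S.
    build : ∀ k {S} → Decidable S → (s : Subset n) → (∀ {v} → S v → v ∈ₛ s) → ∣ s ∣ ≤ k →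
            ∀ {x y} → S x → S y → x ≢ y → SomeBuild S
    build zero S? s S⊆s ∣s∣≤0 Sx _ _ = ⊥-elim (n≮n 0 (<-≤-trans (∈ₛ⇒0<∣∣ (S⊆s Sx)) ∣s∣≤0))
    build (suc k) {S} S? s S⊆s ∣s∣≤1+k Sx Sy x≢y =
      let hs , hearts = heartList S?
          fails : ¬ (hs ≡ [] × Connected G S)
          fails = noFailure hearts Sx Sy x≢y
          cs , collected = ComponentsOf.collect G (Rest G S) (Rest? S?) (allFin n)
          open ComponentsOf.Collected collected
          smaller : ∀ {i c} → cs [ i ]≔ c → ∣ c ∣ ≤ k
          smaller cs[i] = ≤-pred (<-≤-trans
            (Rest-component-smaller S? S⊆s hs hearts fails (≔-All areComponents cs[i])) ∣s∣≤1+k)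
          ts , _ , children = childrenFor cs disjoint λ {_} {c} cs[i] →
            childFor c (≔-All areComponents cs[i]) (build k (_∈ₛ? c) c (λ v∈c → v∈c) (smaller cs[i]))
          comps : Components G (Rest G S) (map ⟦_⟧ cs)
          comps = ComponentsOf.Collected⇒Components G (Rest G S) (Rest? S?) collected
          u , hs-atRoot , children' = truncateHearts hearts comps children
      in node (map leaf hs ++ ts) , u , step hs (map ⟦_⟧ cs) ts hearts fails hs-atRoot comps children'

Un2qBMG⇒HeartTree : ∀ {m} (G : BipGraph (suc m)) → Un2qBMG G →
                    Σ (Tree (suc m)) λ t → Σ (Fin (suc m) → Trunc) λ u → HeartTree G u t
Un2qBMG⇒HeartTree {zero} G _ = leaf zero , (λ _ → atLeaf) , single zero (λ { zero → refl }) refl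
Un2qBMG⇒HeartTree {suc m} G (T , uq , _ , Edge⇔QArc) =
  let t , u , run = Construction.build G T uq Edge⇔QArc (suc (suc m)) (λ _ → yes tt) Subset.⊤ (λ _ → ∈⊤)
                      (∣p∣≤n Subset.⊤) {zero} {suc zero} tt tt (λ ())
  in t , u , multi zero (suc zero) (λ ()) run

theorem5p3 : ∀ {m : ℕ} (G : BipGraph (suc m)) →
    ((Σ (Tree (suc m)) λ t → Σ (Fin (suc m) → Trunc) λ u → HeartTree G u t) ⇔ Un2qBMG G)
    × (∀ t u → HeartTree G u t →
         Σ (PhyloTree (suc m)) λ T →
           PhyloTree.tree T ≡ t × Explains G T u × LeastResolved G T u)
theorem5p3 G =
  mk⇔ (λ (t , u , run) → Explains⇒Un2qBMG G (runTree G u run) u (runTree-Explains G u run))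
      (Un2qBMG⇒HeartTree G)
  , λ t u run → runTree G u run , runTree-tree G u run , runTree-Explains G u run , runTree-LeastResolved G u run
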